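{- Fix integers $k_1,k_2$ with $-1\le k_1\le k_2$ and an integer $m\geq 2k_1+2$. For $(x_1,\ldots,x_{m-1})\in\mathbb{Z}_{\ge 0}^{m-1}$ let $\overline{x}=(x_1,\ldots,x_{2k_1+1})$. There is a bijection between the set of numerical semigroups $S$ with $m(S)=m$, $g(S)=m+k_1$ and $e(S)=g(S)-k_2$, and the set of sequences $(x_1,\ldots,x_{m-1})$ satisfying: (1) $x_1,\ldots,x_{m-1}\in\{1,2,3\}$; (2) if $i\geq 2k_1$ then $x_i\in\{1,2\}$; (3) whenever $i_1,i_2,i_3\in[1,2k_1+1]$ satisfy $i_1+i_2=i_3$, we have $(x_{i_1},x_{i_2},x_{i_3})\neq(1,1,3)$; (4) $\#\{i\in[2k_1+2,m-1]\mid x_i=2\}=k_1+1-a(\overline{x})-2b(\overline{x})$; (5) $a(\overline{x})+b(\overline{x})-c(\overline{x})=2k_1+1-k_2$.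
   Context: A numerical semigroup $S$ is a submonoid of $\mathbb{N}_0$ with finite complement; $g(S)=|\mathbb{N}_0\setminus S|$ is the genus, $m(S)$ the smallest nonzero element (multiplicity), and $e(S)$ the size of the minimal generating set $(S\setminus\{0\})\setminus((S\setminus\{0\})+(S\setminus\{0\}))$. Intervals $[a,b]$ denote sets of integers. For $\overline{x}=(x_1,\ldots,x_t)\in\{1,2,3\}^t$ define $a(\overline{x})=\#\{i\in[1,t]\mid x_i=2\}$, $b(\overline{x})=\#\{i\in[1,t]\mid x_i=3\}$, and $c(\overline{x})=\#\{i\in[1,t]\mid \exists j_1,j_2\in[1,t]:\ j_1+j_2=i,\ (x_{j_1},x_{j_2},x_i)=(1,1,2)\}$. -}

module Defs where

open import Data.Nat as ℕ using (ℕ; zero; suc; _+_; _∸_; _≤_; _<_)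
open import Data.Integer as ℤ using (ℤ; +_; -[1+_])
open import Data.Bool using (Bool; true; false; _∧_; _∨_; not; if_then_else_)
open import Data.Vec using (Vec; []; _∷_)
open import Data.Product using (Σ; _×_; _,_; proj₁)
open import Data.Sum using (_⊎_)
open import Relation.Nullary using (¬_)
open import Relation.Binary.PropositionalEquality
open import Relation.Binary.Bundles using (Setoid)
open import Relation.Binary.Structures using (IsEquivalence)

countBelow : (ℕ → Bool) → ℕ → ℕ
countBelow P zero    = 0
countBelow P (suc n) = countBelow P n + (if P n then 1 else 0)

count1 : (ℕ → Bool) → ℕ → ℕ
count1 P zero    = 0
count1 P (suc n) = count1 P n + (if P (suc n) then 1 else 0)

any1 : (ℕ → Bool) → ℕ → Bool
any1 P zero    = false
any1 P (suc n) = any1 P n ∨ P (suc n)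

HasCard : (ℕ → Bool) → ℕ → Set
HasCard P c = Σ ℕ λ N → (∀ n → N ≤ n → P n ≡ false) × (countBelow P N ≡ c)

record NumericalSemigroup : Set where
  field
    mem      : ℕ → Bool
    zero-mem : mem 0 ≡ true
    closed   : ∀ a b → mem a ≡ true → mem b ≡ true → mem (a + b) ≡ true
    cofinite : Σ ℕ λ N → ∀ n → N ≤ n → mem n ≡ true

open NumericalSemigroup public

isZero : ℕ → Bool
isZero zero    = true
isZero (suc _) = false

-- n is a minimal generator: n ∈ S∖{0} and n ∉ (S∖{0}) + (S∖{0})
isMinGen : NumericalSemigroup → ℕ → Bool
isMinGen S n =
  not (isZero n) ∧ mem S n ∧ not (any1 (λ a → mem S a ∧ mem S (n ∸ a)) (n ∸ 1))

IsMultiplicity : NumericalSemigroup → ℕ → Set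
IsMultiplicity S m =
  (0 < m) × (mem S m ≡ true) × (∀ n → 0 < n → n < m → mem S n ≡ false)

HasGenus : NumericalSemigroup → ℕ → Set
HasGenus S g = HasCard (λ n → not (mem S n)) g

HasEmbDim : NumericalSemigroup → ℕ → Set
HasEmbDim S e = HasCard (isMinGen S) e

SemigroupsWith : ℕ → ℤ → ℤ → Set
SemigroupsWith m k₁ k₂ =
  Σ NumericalSemigroup λ S → IsMultiplicity S m ×
    (Σ ℕ λ g → Σ ℕ λ e → HasGenus S g × HasEmbDim S e ×
       (+ g ≡ + m ℤ.+ k₁) × (+ e ≡ + g ℤ.- k₂))

SemigroupSetoid : ℕ → ℤ → ℤ → Setoid _ _
SemigroupSetoid m k₁ k₂ = record
  { Carrier = SemigroupsWith m k₁ k₂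
  ; _≈_ = λ A B → ∀ n → mem (proj₁ A) n ≡ mem (proj₁ B) n
  ; isEquivalence = record
      { refl  = λ n → refl
      ; sym   = λ p n → sym (p n)
      ; trans = λ p q n → trans (p n) (q n) }
  }

-- 1-indexed access: at (x₁,…,x_L) i = x_i for i ∈ [1,L] (0 otherwise; unused)
at : ∀ {n} → Vec ℕ n → ℕ → ℕ
at []       _             = 0
at (x ∷ xs) zero          = 0
at (x ∷ xs) (suc zero)    = x
at (x ∷ xs) (suc (suc i)) = at xs (suc i)

_==_ : ℕ → ℕ → Bool
a == b = a ℕ.≡ᵇ b

clamp : ℤ → ℕ
clamp (+ n)    = n
clamp -[1+ _ ] = 0

-- For a tuple x̄ = (x₁,…,x_t), given as t and the 1-indexed access x:
aOf : ℕ → (ℕ → ℕ) → ℕ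
aOf t x = count1 (λ i → x i == 2) t

bOf : ℕ → (ℕ → ℕ) → ℕ
bOf t x = count1 (λ i → x i == 3) t

cOf : ℕ → (ℕ → ℕ) → ℕ
cOf t x = count1 (λ i → any1 (λ j₁ → any1 (λ j₂ →
            ((j₁ + j₂) == i) ∧ (x j₁ == 1) ∧ (x j₂ == 1) ∧ (x i == 2)) t) t) t

ValidSeq : (m : ℕ) → ℤ → ℤ → Vec ℕ (m ∸ 1) → Set
ValidSeq m k₁ k₂ xs =
  (∀ i → 1 ≤ i → i ≤ L → x i ≡ 1 ⊎ x i ≡ 2 ⊎ x i ≡ 3) ×
  (∀ i → 1 ≤ i → i ≤ L → 2k₁ ℤ.≤ + i → x i ≡ 1 ⊎ x i ≡ 2) ×
  (∀ i₁ i₂ i₃ → 1 ≤ i₁ → + i₁ ℤ.≤ 2k₁+1 → 1 ≤ i₂ → + i₂ ℤ.≤ 2k₁+1 →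
     1 ≤ i₃ → + i₃ ℤ.≤ 2k₁+1 → i₁ + i₂ ≡ i₃ →
     ¬ (x i₁ ≡ 1 × x i₂ ≡ 1 × x i₃ ≡ 3)) ×
  (+ count1 (λ i → (2k₁ ℤ.+ + 2 ℤ.≤ᵇ + i) ∧ (x i == 2)) L
     ≡ k₁ ℤ.+ + 1 ℤ.- + aOf t x ℤ.- + 2 ℤ.* + bOf t x) ×
  (+ aOf t x ℤ.+ + bOf t x ℤ.- + cOf t x ≡ 2k₁+1 ℤ.- k₂)
  where
    L : ℕ
    L = m ∸ 1
    x : ℕ → ℕ
    x = at xs
    2k₁ : ℤ
    2k₁ = + 2 ℤ.* k₁
    2k₁+1 : ℤ
    2k₁+1 = 2k₁ ℤ.+ + 1
    t : ℕ        -- length of x̄ = (x₁,…,x_{2k₁+1}) (0 if 2k₁+1 < 0)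
    t = clamp 2k₁+1

SequencesWith : ℕ → ℤ → ℤ → Set
SequencesWith m k₁ k₂ = Σ (Vec ℕ (m ∸ 1)) (ValidSeq m k₁ k₂)

SequenceSetoid : ℕ → ℤ → ℤ → Setoid _ _
SequenceSetoid m k₁ k₂ = record
  { Carrier = SequencesWith m k₁ k₂
  ; _≈_ = λ A B → proj₁ A ≡ proj₁ B
  ; isEquivalence = record { refl = refl ; sym = sym ; trans = trans }
  }

module Submission where

-- A numerical semigroup S of multiplicity m is determined by its Kunz coordinates: x r, for a
-- residue r < m, is the least q with r + q m ∈ S. Closure under addition amounts to the Kunz
-- inequalities x (j + k) ≤ x j + x k (j + k < m) and x (j + k − m) ≤ x j + x k + 1, the genus is
-- Σ x r, and the minimal generators other than m are the Apéry elements r + x r m that are not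
-- sums of two other Apéry elements. The sequence attached to S is (x 1, …, x (m − 1)).
-- If g(S) = m + k₁ with 2 k₁ + 2 ≤ m, then for a fixed i the other residues split into pairs
-- with sum i or i + m; summing the Kunz inequalities over these pairs against Σ x = g = m + k₁
-- shows x i ≤ 3, and x i = 3 only for i ≤ 2 k₁ + 1. With this, conditions (1)–(3) encode the Kunz
-- inequalities, Σ x = (m − 1) + a + 2 b + #{i ≥ 2 k₁ + 2 | x i = 2} gives (4), and since every
-- residue i ≠ 0 is counted exactly once by e(S) − 1, b, c or #{i ≥ 2 k₁ + 2 | x i = 2}, (5) holds.

open import Defs
open import Data.Nat as ℕ using (ℕ; _≤_)
open import Data.Integer as ℤ using (ℤ; +_; -[1+_])
open import Function.Bundles using (Bijection; Equivalence; _⇔_; mk⇔)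

open import Data.Nat using (zero; suc; _+_; _*_; _∸_; _<_; z≤n; s≤s; _≤ᵇ_)
open import Data.Nat.Properties
open import Data.Nat.DivMod using (_/_; _%_; m≡m%n+[m/n]*n; m%n<n; [m+kn]%n≡m%n; m<n⇒m%n≡m; m*n/n≡m; /-monoˡ-≤)
open import Data.Nat.Tactic.RingSolver using (solve-∀)
import Data.Integer.Properties as ℤP
import Data.Integer.Tactic.RingSolver as ℤR
open import Data.Bool using (Bool; true; false; _∧_; _∨_; not; if_then_else_)
open import Data.Bool.Properties using (T-≡; ∧-zeroʳ; ∧-conicalˡ; ∧-conicalʳ)
open import Data.Vec using (Vec; []; _∷_)
open import Data.Product using (Σ; ∃; _×_; _,_; proj₁; proj₂)
open import Data.Sum using (_⊎_; inj₁; inj₂)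
open import Data.Empty using (⊥; ⊥-elim)
open import Relation.Nullary using (¬_; yes; no)
open import Relation.Binary.PropositionalEquality
open import Relation.Binary using (tri<; tri≈; tri>)

true≢false : true ≢ false
true≢false ()

≤ᵇ-true : ∀ a b → a ≤ b → (a ≤ᵇ b) ≡ true
≤ᵇ-true a b p = Equivalence.to T-≡ (≤⇒≤ᵇ p)

≤ᵇ-true⇒≤ : ∀ a b → (a ≤ᵇ b) ≡ true → a ≤ b
≤ᵇ-true⇒≤ a b e = ≤ᵇ⇒≤ a b (Equivalence.from T-≡ e)

≤ᵇ-false : ∀ a b → b < a → (a ≤ᵇ b) ≡ false
≤ᵇ-false a b b<a with a ≤ᵇ b in e
... | false = refl
... | true  = ⊥-elim (<⇒≱ b<a (≤ᵇ-true⇒≤ a b e))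

==-true : ∀ a b → a ≡ b → (a == b) ≡ true
==-true a b p = Equivalence.to T-≡ (≡⇒≡ᵇ a b p)

==-true⇒≡ : ∀ a b → (a == b) ≡ true → a ≡ b
==-true⇒≡ a b e = ≡ᵇ⇒≡ a b (Equivalence.from T-≡ e)

==-false : ∀ a b → a ≢ b → (a == b) ≡ false
==-false a b a≢b with a == b in e
... | false = refl
... | true  = ⊥-elim (a≢b (==-true⇒≡ a b e))

==-false⇒≢ : ∀ a b → (a == b) ≡ false → a ≢ b
==-false⇒≢ a b e a≡b = true≢false (trans (sym (==-true a b a≡b)) e)

∧-true : ∀ {a b} → a ≡ true → b ≡ true → (a ∧ b) ≡ true
∧-true refl refl = refl

∧-false : ∀ a b → (a ≡ true → b ≡ true → ⊥) → (a ∧ b) ≡ false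
∧-false true  true  h = ⊥-elim (h refl refl)
∧-false true  false h = refl
∧-false false b     h = refl

bool-dec : ∀ (b : Bool) → b ≡ true ⊎ b ≡ false
bool-dec true  = inj₁ refl
bool-dec false = inj₂ refl

indicator : Bool → ℕ
indicator b = if b then 1 else 0

sumBelow : (ℕ → ℕ) → ℕ → ℕ
sumBelow f zero    = 0
sumBelow f (suc n) = sumBelow f n + f n

sum1 : (ℕ → ℕ) → ℕ → ℕ
sum1 f = sumBelow (λ i → f (suc i))

countBelow≡sumBelow : ∀ P n → countBelow P n ≡ sumBelow (λ i → indicator (P i)) n
countBelow≡sumBelow P zero    = refl
countBelow≡sumBelow P (suc n) = cong (_+ indicator (P n)) (countBelow≡sumBelow P n)

count1≡sum1 : ∀ P n → count1 P n ≡ sum1 (λ i → indicator (P i)) n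
count1≡sum1 P zero    = refl
count1≡sum1 P (suc n) = cong (_+ indicator (P (suc n))) (count1≡sum1 P n)

sumBelow-cong : ∀ f g n → (∀ i → i < n → f i ≡ g i) → sumBelow f n ≡ sumBelow g n
sumBelow-cong f g zero    h = refl
sumBelow-cong f g (suc n) h =
  cong₂ _+_ (sumBelow-cong f g n (λ i i<n → h i (m≤n⇒m≤1+n i<n))) (h n ≤-refl)

sum1-cong : ∀ f g n → (∀ i → 1 ≤ i → i ≤ n → f i ≡ g i) → sum1 f n ≡ sum1 g n
sum1-cong f g n h = sumBelow-cong _ _ n (λ i i<n → h (suc i) (s≤s z≤n) i<n)

sumBelow-mono : ∀ f g n → (∀ i → i < n → f i ≤ g i) → sumBelow f n ≤ sumBelow g n
sumBelow-mono f g zero    h = z≤n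
sumBelow-mono f g (suc n) h =
  +-mono-≤ (sumBelow-mono f g n (λ i i<n → h i (m≤n⇒m≤1+n i<n))) (h n ≤-refl)

sum1-mono : ∀ f g n → (∀ i → 1 ≤ i → i ≤ n → f i ≤ g i) → sum1 f n ≤ sum1 g n
sum1-mono f g n h = sumBelow-mono _ _ n (λ i i<n → h (suc i) (s≤s z≤n) i<n)

sumBelow-+ : ∀ f g n → sumBelow (λ i → f i + g i) n ≡ sumBelow f n + sumBelow g n
sumBelow-+ f g zero    = refl
sumBelow-+ f g (suc n) = begin
  sumBelow (λ i → f i + g i) n + (f n + g n)    ≡⟨ cong (_+ (f n + g n)) (sumBelow-+ f g n) ⟩
  sumBelow f n + sumBelow g n + (f n + g n)     ≡⟨ +-interchange (sumBelow f n) _ _ _ ⟩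
  sumBelow f n + f n + (sumBelow g n + g n)     ∎
  where
  open ≡-Reasoning
  +-interchange : ∀ a b c d → a + b + (c + d) ≡ a + c + (b + d)
  +-interchange = solve-∀

sum1-+ : ∀ f g n → sum1 (λ i → f i + g i) n ≡ sum1 f n + sum1 g n
sum1-+ f g = sumBelow-+ (λ i → f (suc i)) (λ i → g (suc i))

sumBelow-const : ∀ c n → sumBelow (λ _ → c) n ≡ n * c
sumBelow-const c zero    = refl
sumBelow-const c (suc n) = trans (cong (_+ c) (sumBelow-const c n)) (+-comm (n * c) c)

sum1-const : ∀ c n → sum1 (λ _ → c) n ≡ n * c
sum1-const = sumBelow-const

sumBelow-*ˡ : ∀ c f n → sumBelow (λ i → c * f i) n ≡ c * sumBelow f n
sumBelow-*ˡ c f zero    = sym (*-zeroʳ c)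
sumBelow-*ˡ c f (suc n) =
  trans (cong (_+ c * f n) (sumBelow-*ˡ c f n)) (sym (*-distribˡ-+ c (sumBelow f n) (f n)))

sumBelow-split : ∀ f a b → sumBelow f (a + b) ≡ sumBelow f a + sumBelow (λ i → f (a + i)) b
sumBelow-split f a zero    = trans (cong (sumBelow f) (+-identityʳ a)) (sym (+-identityʳ _))
sumBelow-split f a (suc b) rewrite +-suc a b | sumBelow-split f a b = +-assoc (sumBelow f a) _ _

sum1-split : ∀ f a b → sum1 f (a + b) ≡ sum1 f a + sum1 (λ i → f (a + i)) b
sum1-split f a b = trans (sumBelow-split (λ i → f (suc i)) a b)
  (cong (λ s → sum1 f a + s) (sumBelow-cong _ _ b (λ i _ → cong f (sym (+-suc a i)))))

sumBelow-suc : ∀ f n → sumBelow f (suc n) ≡ f 0 + sum1 f n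
sumBelow-suc f zero    = +-comm 0 (f 0)
sumBelow-suc f (suc n) rewrite sumBelow-suc f n = +-assoc (f 0) _ _

sum1-reverse : ∀ f n → sum1 (λ j → f (suc n ∸ j)) n ≡ sum1 f n
sum1-reverse f zero    = refl
sum1-reverse f (suc n) = begin
  sum1 (λ j → f (suc (suc n) ∸ j)) n + f (suc n ∸ n)
    ≡⟨ cong (λ v → sum1 (λ j → f (suc (suc n) ∸ j)) n + f v) (m+n∸n≡m 1 n) ⟩
  sum1 (λ j → f (suc (suc n) ∸ j)) n + f 1
    ≡⟨ cong (_+ f 1) (sum1-cong _ _ n (λ i _ i≤n → cong f (+-∸-assoc 1 (m≤n⇒m≤1+n i≤n)))) ⟩
  sum1 (λ j → f (suc (suc n ∸ j))) n + f 1
    ≡⟨ cong (_+ f 1) (sum1-reverse (λ i → f (suc i)) n) ⟩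
  sum1 (λ i → f (suc i)) n + f 1
    ≡⟨ +-comm _ (f 1) ⟩
  f 1 + sum1 (λ i → f (suc i)) n
    ≡⟨ sym (sumBelow-suc (λ i → f (suc i)) n) ⟩
  sum1 f (suc n) ∎
  where open ≡-Reasoning

sum1-pairing-bound : ∀ f n c → (∀ j → 1 ≤ j → j ≤ n → c ≤ f j + f (suc n ∸ j)) → n * c ≤ 2 * sum1 f n
sum1-pairing-bound f n c pairs = begin
  n * c                                          ≡⟨ sym (sum1-const c n) ⟩
  sum1 (λ _ → c) n                               ≤⟨ sum1-mono _ _ n pairs ⟩
  sum1 (λ j → f j + f (suc n ∸ j)) n             ≡⟨ sum1-+ f (λ j → f (suc n ∸ j)) n ⟩
  sum1 f n + sum1 (λ j → f (suc n ∸ j)) n        ≡⟨ cong (λ s → sum1 f n + s) (sum1-reverse f n) ⟩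
  sum1 f n + sum1 f n                            ≡⟨ cong (λ s → sum1 f n + s) (sym (+-identityʳ (sum1 f n))) ⟩
  2 * sum1 f n                                   ∎
  where open ≤-Reasoning

sumBelow-swap : ∀ (h : ℕ → ℕ → ℕ) Q M →
  sumBelow (λ q → sumBelow (h q) M) Q ≡ sumBelow (λ r → sumBelow (λ q → h q r) Q) M
sumBelow-swap h zero    M = sym (trans (sumBelow-const 0 M) (*-zeroʳ M))
sumBelow-swap h (suc Q) M rewrite sumBelow-swap h Q M =
  sym (sumBelow-+ (λ r → sumBelow (λ q → h q r) Q) (λ r → h Q r) M)

sumBelow-single : ∀ f n v → v < n → (∀ q → q < n → q ≢ v → f q ≡ 0) → sumBelow f n ≡ f v
sumBelow-single f (suc n) v v<1+n h with m≤n⇒m<n∨m≡n (≤-pred v<1+n)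
... | inj₁ v<n rewrite sumBelow-single f n v v<n (λ q q<n → h q (m≤n⇒m≤1+n q<n))
                     | h n ≤-refl (λ n≡v → <⇒≢ v<n (sym n≡v)) = +-identityʳ (f v)
... | inj₂ refl = cong (_+ f n) (trans (sumBelow-cong f (λ _ → 0) n (λ q q<n → h q (m≤n⇒m≤1+n q<n) (<⇒≢ q<n)))
                                       (trans (sumBelow-const 0 n) (*-zeroʳ n)))

sum1-vanishing-tail : ∀ f t l → (∀ i → t < i → i ≤ t + l → f i ≡ 0) → sum1 f (t + l) ≡ sum1 f t
sum1-vanishing-tail f t l h = begin
  sum1 f (t + l)                           ≡⟨ sum1-split f t l ⟩
  sum1 f t + sum1 (λ i → f (t + i)) l      ≡⟨ cong (λ s → sum1 f t + s) tail≡0 ⟩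
  sum1 f t + 0                             ≡⟨ +-identityʳ _ ⟩
  sum1 f t                                 ∎
  where
  open ≡-Reasoning
  tail≡0 : sum1 (λ i → f (t + i)) l ≡ 0
  tail≡0 = trans (sum1-cong _ (λ _ → 0) l (λ i 1≤i i≤l →
                    h (t + i) (subst (_≤ t + i) (+-comm t 1) (+-monoʳ-≤ t 1≤i)) (+-monoʳ-≤ t i≤l)))
                 (trans (sum1-const 0 l) (*-zeroʳ l))

countBelow-stable : ∀ P N l → (∀ n → N ≤ n → P n ≡ false) → countBelow P (N + l) ≡ countBelow P N
countBelow-stable P N zero    h = cong (countBelow P) (+-identityʳ N)
countBelow-stable P N (suc l) h
  rewrite +-suc N l | countBelow-stable P N l h | h (N + l) (m≤m+n N l) = +-identityʳ _

hasCard-unique : ∀ P c N → HasCard P c → (∀ n → N ≤ n → P n ≡ false) → c ≡ countBelow P N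
hasCard-unique P c N (N' , h' , e') h = begin
  c                        ≡⟨ sym e' ⟩
  countBelow P N'          ≡⟨ sym (countBelow-stable P N' N h') ⟩
  countBelow P (N' + N)    ≡⟨ cong (countBelow P) (+-comm N' N) ⟩
  countBelow P (N + N')    ≡⟨ countBelow-stable P N N' h ⟩
  countBelow P N           ∎
  where open ≡-Reasoning

countBelow-cong : ∀ P Q n → (∀ i → P i ≡ Q i) → countBelow P n ≡ countBelow Q n
countBelow-cong P Q zero    h = refl
countBelow-cong P Q (suc n) h rewrite countBelow-cong P Q n h | h n = refl

sumBelow-indicator-< : ∀ c Q → c ≤ Q → sumBelow (λ q → indicator (not (c ≤ᵇ q))) Q ≡ c
sumBelow-indicator-< zero    zero    _ = refl
sumBelow-indicator-< c       (suc Q) c≤1+Q with m≤n⇒m<n∨m≡n c≤1+Q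
... | inj₁ (s≤s c≤Q) rewrite sumBelow-indicator-< c Q c≤Q | ≤ᵇ-true c Q c≤Q = +-identityʳ c
... | inj₂ refl rewrite ≤ᵇ-false (suc Q) Q ≤-refl = begin
  sumBelow (λ q → indicator (not (suc Q ≤ᵇ q))) Q + 1   ≡⟨ cong (_+ 1) all-ones ⟩
  Q * 1 + 1                                             ≡⟨ cong (_+ 1) (*-identityʳ Q) ⟩
  Q + 1                                                 ≡⟨ +-comm Q 1 ⟩
  suc Q                                                 ∎
  where
  open ≡-Reasoning
  all-ones : sumBelow (λ q → indicator (not (suc Q ≤ᵇ q))) Q ≡ Q * 1
  all-ones = trans (sumBelow-cong _ (λ _ → 1) Q (λ q q<Q → cong (λ b → indicator (not b)) (≤ᵇ-false (suc Q) q (m≤n⇒m≤1+n q<Q))))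
                   (sumBelow-const 1 Q)

least : (ℕ → Bool) → ℕ → ℕ
least P zero    = 0
least P (suc n) = if P 0 then 0 else suc (least (λ q → P (suc q)) n)

least-spec : ∀ P n → P n ≡ true → P (least P n) ≡ true × (∀ q → q < least P n → P q ≡ false)
least-spec P zero    Pn = Pn , λ q ()
least-spec P (suc n) Pn with P 0 in P0
... | true  = P0 , λ q ()
... | false with least-spec (λ q → P (suc q)) n Pn
...   | Pℓ , below = Pℓ , λ { zero _ → P0 ; (suc q) (s≤s q<ℓ) → below q q<ℓ }

minimal-witness-unique : ∀ (P : ℕ → Bool) a b →
  P a ≡ true → (∀ q → q < a → P q ≡ false) →
  P b ≡ true → (∀ q → q < b → P q ≡ false) → a ≡ b
minimal-witness-unique P a b Pa below-a Pb below-b with <-cmp a b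
... | tri< a<b _ _ = ⊥-elim (true≢false (trans (sym Pa) (below-b a a<b)))
... | tri≈ _ a≡b _ = a≡b
... | tri> _ _ b<a = ⊥-elim (true≢false (trans (sym Pb) (below-a b b<a)))

any1-true⇒ : ∀ P n → any1 P n ≡ true → ∃ λ j → 1 ≤ j × j ≤ n × P j ≡ true
any1-true⇒ P (suc n) e with any1 P n in before | P (suc n) in last
... | true  | _    = let (j , 1≤j , j≤n , Pj) = any1-true⇒ P n before in j , 1≤j , m≤n⇒m≤1+n j≤n , Pj
... | false | true = suc n , s≤s z≤n , ≤-refl , last

any1-intro : ∀ P n j → 1 ≤ j → j ≤ n → P j ≡ true → any1 P n ≡ true
any1-intro P zero    zero () _ _
any1-intro P (suc n) j 1≤j j≤1+n Pj with m≤n⇒m<n∨m≡n j≤1+n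
... | inj₁ (s≤s j≤n) rewrite any1-intro P n j 1≤j j≤n Pj = refl
... | inj₂ refl rewrite Pj = ∨-true (any1 P n)
  where
  ∨-true : ∀ b → (b ∨ true) ≡ true
  ∨-true true  = refl
  ∨-true false = refl

any1-false : ∀ P n → (∀ j → 1 ≤ j → j ≤ n → P j ≡ false) → any1 P n ≡ false
any1-false P zero    h = refl
any1-false P (suc n) h
  rewrite any1-false P n (λ j 1≤j j≤n → h j 1≤j (m≤n⇒m≤1+n j≤n)) | h (suc n) (s≤s z≤n) ≤-refl = refl

any1-false⇒ : ∀ P n → any1 P n ≡ false → ∀ j → 1 ≤ j → j ≤ n → P j ≡ false
any1-false⇒ P n e j 1≤j j≤n with P j in Pj
... | false = refl
... | true  = ⊥-elim (true≢false (trans (sym (any1-intro P n j 1≤j j≤n Pj)) e))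

tabulate1 : (ℕ → ℕ) → (n : ℕ) → Vec ℕ n
tabulate1 f zero    = []
tabulate1 f (suc n) = f 1 ∷ tabulate1 (λ i → f (suc i)) n

at-tabulate1 : ∀ f n i → 1 ≤ i → i ≤ n → at (tabulate1 f n) i ≡ f i
at-tabulate1 f (suc n) (suc zero)    _ _         = refl
at-tabulate1 f (suc n) (suc (suc i)) _ (s≤s i≤n) = at-tabulate1 (λ j → f (suc j)) n (suc i) (s≤s z≤n) i≤n

at-0 : ∀ {n} (v : Vec ℕ n) → at v 0 ≡ 0
at-0 []      = refl
at-0 (_ ∷ _) = refl

tabulate1-cong : ∀ f g n → (∀ i → 1 ≤ i → i ≤ n → f i ≡ g i) → tabulate1 f n ≡ tabulate1 g n
tabulate1-cong f g zero    h = refl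
tabulate1-cong f g (suc n) h =
  cong₂ _∷_ (h 1 (s≤s z≤n) (s≤s z≤n)) (tabulate1-cong _ _ n (λ i _ i≤n → h (suc i) (s≤s z≤n) (s≤s i≤n)))

tabulate1-at : ∀ {n} (v : Vec ℕ n) → tabulate1 (at v) n ≡ v
tabulate1-at []                = refl
tabulate1-at {suc n} (a ∷ v) =
  cong (a ∷_) (trans (tabulate1-cong _ (at v) n (λ { (suc i) _ _ → refl })) (tabulate1-at v))

-- Kunz coordinates

module Kunz (L : ℕ) where

  m : ℕ
  m = suc L

  kunzMem : (ℕ → ℕ) → ℕ → Bool
  kunzMem x n = x (n % m) ≤ᵇ n / m

  divMod-decomp : ∀ n → n ≡ n % m + n / m * m
  divMod-decomp n = m≡m%n+[m/n]*n n m

  mod<m : ∀ n → n % m < m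
  mod<m n = m%n<n n m

  m≡0+1*m : m ≡ 0 + 1 * m
  m≡0+1*m = cong suc (sym (+-identityʳ L))

  %-of-decomp : ∀ r q → r < m → (r + q * m) % m ≡ r
  %-of-decomp r q r<m = trans ([m+kn]%n≡m%n r q m) (m<n⇒m%n≡m r<m)

  /-of-decomp : ∀ r q → r < m → (r + q * m) / m ≡ q
  /-of-decomp r q r<m = sym (*-cancelʳ-≡ q ((r + q * m) / m) m (+-cancelˡ-≡ r _ _ (begin
    r + q * m                                ≡⟨ divMod-decomp (r + q * m) ⟩
    (r + q * m) % m + (r + q * m) / m * m    ≡⟨ cong (_+ (r + q * m) / m * m) (%-of-decomp r q r<m) ⟩
    r + (r + q * m) / m * m                  ∎)))
    where open ≡-Reasoning

  kunzMem-decomp : ∀ x r q → r < m → kunzMem x (r + q * m) ≡ (x r ≤ᵇ q)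
  kunzMem-decomp x r q r<m = cong₂ (λ a b → x a ≤ᵇ b) (%-of-decomp r q r<m) (/-of-decomp r q r<m)

  ext-decomp : ∀ (P Q : ℕ → Bool) → (∀ r q → r < m → P (r + q * m) ≡ Q (r + q * m)) → ∀ n → P n ≡ Q n
  ext-decomp P Q h n =
    trans (cong P (divMod-decomp n)) (trans (h (n % m) (n / m) (mod<m n)) (cong Q (sym (divMod-decomp n))))

  kunzMem-above : ∀ x Q n → (∀ r → r < m → x r ≤ Q) → Q * m ≤ n → kunzMem x n ≡ true
  kunzMem-above x Q n bound Qm≤n = ≤ᵇ-true (x (n % m)) (n / m) (≤-trans (bound (n % m) (mod<m n)) Q≤n/m)
    where
    Q≤n/m : Q ≤ n / m
    Q≤n/m = subst (_≤ n / m) (m*n/n≡m Q m) (/-monoˡ-≤ m Qm≤n)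

  wrapped-residue : ∀ {j k} → j < m → k < m → m ≤ j + k → j + k ∸ m < m × j + k ≡ (j + k ∸ m) + m
  wrapped-residue {j} {k} j<m k<m m≤j+k =
    +-cancelʳ-< m (j + k ∸ m) m (subst (_< m + m) j+k≡ (+-mono-< j<m k<m)) , j+k≡
    where
    j+k≡ : j + k ≡ (j + k ∸ m) + m
    j+k≡ = sym (m∸n+n≡m m≤j+k)

  KunzInequalities : (ℕ → ℕ) → Set
  KunzInequalities x = ∀ j k → j < m → k < m →
    (j + k < m → x (j + k) ≤ x j + x k) × (m ≤ j + k → x (j + k ∸ m) ≤ suc (x j + x k))

  regroup : ∀ j a k b → j + a * m + (k + b * m) ≡ (j + k) + (a + b) * m
  regroup j a k b = regroup′ j a k b m
    where
    regroup′ : ∀ j a k b m → j + a * m + (k + b * m) ≡ (j + k) + (a + b) * m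
    regroup′ = solve-∀

  regroup-wrapped : ∀ j a k b s → j + k ≡ s + m → j + a * m + (k + b * m) ≡ s + suc (a + b) * m
  regroup-wrapped j a k b s j+k≡ = trans (regroup j a k b) (trans (cong (_+ (a + b) * m) j+k≡) (carry s (a + b) m))
    where
    carry : ∀ s c m → s + m + c * m ≡ s + suc c * m
    carry = solve-∀

  kunzMem-closed-decomp : ∀ x → KunzInequalities x → ∀ j a k b → j < m → k < m → x j ≤ a → x k ≤ b →
    kunzMem x (j + a * m + (k + b * m)) ≡ true
  kunzMem-closed-decomp x ki j a k b j<m k<m xj≤a xk≤b with j + k ℕ.<? m
  ... | yes j+k<m = begin
    kunzMem x (j + a * m + (k + b * m))    ≡⟨ cong (kunzMem x) (regroup j a k b) ⟩
    kunzMem x (j + k + (a + b) * m)        ≡⟨ kunzMem-decomp x (j + k) (a + b) j+k<m ⟩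
    x (j + k) ≤ᵇ a + b                     ≡⟨ ≤ᵇ-true _ _ (≤-trans (proj₁ (ki j k j<m k<m) j+k<m) (+-mono-≤ xj≤a xk≤b)) ⟩
    true                                   ∎
    where open ≡-Reasoning
  ... | no j+k≮m = begin
    kunzMem x (j + a * m + (k + b * m))    ≡⟨ cong (kunzMem x) (regroup-wrapped j a k b s j+k≡) ⟩
    kunzMem x (s + suc (a + b) * m)        ≡⟨ kunzMem-decomp x s (suc (a + b)) s<m ⟩
    x s ≤ᵇ suc (a + b)                     ≡⟨ ≤ᵇ-true _ _ (≤-trans (proj₂ (ki j k j<m k<m) m≤j+k) (s≤s (+-mono-≤ xj≤a xk≤b))) ⟩
    true                                   ∎
    where
    open ≡-Reasoning
    m≤j+k : m ≤ j + k
    m≤j+k = ≮⇒≥ j+k≮m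
    s : ℕ
    s = j + k ∸ m
    s<m : s < m
    s<m = proj₁ (wrapped-residue j<m k<m m≤j+k)
    j+k≡ : j + k ≡ s + m
    j+k≡ = proj₂ (wrapped-residue j<m k<m m≤j+k)

  kunzMem-true⇒ : ∀ x n → kunzMem x n ≡ true → x (n % m) ≤ n / m
  kunzMem-true⇒ x n = ≤ᵇ-true⇒≤ (x (n % m)) (n / m)

  kunzMem-closed : ∀ x → KunzInequalities x → ∀ a b → kunzMem x a ≡ true → kunzMem x b ≡ true → kunzMem x (a + b) ≡ true
  kunzMem-closed x ki a b a∈ b∈ =
    trans (cong (kunzMem x) (cong₂ _+_ (divMod-decomp a) (divMod-decomp b)))
          (kunzMem-closed-decomp x ki (a % m) (a / m) (b % m) (b / m) (mod<m a) (mod<m b)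
                                 (kunzMem-true⇒ x a a∈) (kunzMem-true⇒ x b b∈))

  closed⇒KunzInequalities : ∀ x → (∀ a b → kunzMem x a ≡ true → kunzMem x b ≡ true → kunzMem x (a + b) ≡ true) →
    KunzInequalities x
  closed⇒KunzInequalities x closed j k j<m k<m = direct , wrapped
    where
    apery∈ : ∀ r → r < m → kunzMem x (r + x r * m) ≡ true
    apery∈ r r<m = trans (kunzMem-decomp x r (x r) r<m) (≤ᵇ-true (x r) (x r) ≤-refl)
    sum∈ : kunzMem x (j + x j * m + (k + x k * m)) ≡ true
    sum∈ = closed (j + x j * m) (k + x k * m) (apery∈ j j<m) (apery∈ k k<m)
    direct : j + k < m → x (j + k) ≤ x j + x k
    direct j+k<m = ≤ᵇ-true⇒≤ _ _ (trans (sym (kunzMem-decomp x (j + k) (x j + x k) j+k<m))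
                                   (trans (cong (kunzMem x) (sym (regroup j (x j) k (x k)))) sum∈))
    wrapped : m ≤ j + k → x (j + k ∸ m) ≤ suc (x j + x k)
    wrapped m≤j+k = ≤ᵇ-true⇒≤ _ _ (trans (sym (kunzMem-decomp x s (suc (x j + x k)) s<m))
                                    (trans (cong (kunzMem x) (sym (regroup-wrapped j (x j) k (x k) s j+k≡))) sum∈))
      where
      s : ℕ
      s = j + k ∸ m
      s<m : s < m
      s<m = proj₁ (wrapped-residue j<m k<m m≤j+k)
      j+k≡ : j + k ≡ s + m
      j+k≡ = proj₂ (wrapped-residue j<m k<m m≤j+k)

  countBelow-blocks : ∀ P Q → countBelow P (Q * m) ≡ sumBelow (λ q → sumBelow (λ r → indicator (P (r + q * m))) m) Q
  countBelow-blocks P zero    = refl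
  countBelow-blocks P (suc Q) = begin
    countBelow P (m + Q * m)
      ≡⟨ cong (countBelow P) (+-comm m (Q * m)) ⟩
    countBelow P (Q * m + m)
      ≡⟨ countBelow≡sumBelow P (Q * m + m) ⟩
    sumBelow (λ i → indicator (P i)) (Q * m + m)
      ≡⟨ sumBelow-split _ (Q * m) m ⟩
    sumBelow (λ i → indicator (P i)) (Q * m) + sumBelow (λ i → indicator (P (Q * m + i))) m
      ≡⟨ cong₂ _+_ (trans (sym (countBelow≡sumBelow P (Q * m))) (countBelow-blocks P Q))
                   (sumBelow-cong _ _ m (λ i _ → cong (λ v → indicator (P v)) (+-comm (Q * m) i))) ⟩
    sumBelow (λ q → sumBelow (λ r → indicator (P (r + q * m))) m) Q + sumBelow (λ r → indicator (P (r + Q * m))) m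
      ∎
    where open ≡-Reasoning

  -- The gaps in residue class r are r, r + m, …, r + (x r − 1) m.
  kunz-genus : ∀ x Q → x 0 ≡ 0 → (∀ r → r < m → x r ≤ Q) → countBelow (λ n → not (kunzMem x n)) (Q * m) ≡ sum1 x L
  kunz-genus x Q x0≡0 bound = begin
    countBelow (λ n → not (kunzMem x n)) (Q * m)
      ≡⟨ countBelow-blocks _ Q ⟩
    sumBelow (λ q → sumBelow (λ r → indicator (not (kunzMem x (r + q * m)))) m) Q
      ≡⟨ sumBelow-cong _ _ Q (λ q _ → sumBelow-cong _ _ m (λ r r<m → cong (λ b → indicator (not b)) (kunzMem-decomp x r q r<m))) ⟩
    sumBelow (λ q → sumBelow (λ r → indicator (not (x r ≤ᵇ q))) m) Q
      ≡⟨ sumBelow-swap (λ q r → indicator (not (x r ≤ᵇ q))) Q m ⟩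
    sumBelow (λ r → sumBelow (λ q → indicator (not (x r ≤ᵇ q))) Q) m
      ≡⟨ sumBelow-cong _ _ m (λ r r<m → sumBelow-indicator-< (x r) Q (bound r r<m)) ⟩
    sumBelow x m
      ≡⟨ sumBelow-suc x L ⟩
    x 0 + sum1 x L
      ≡⟨ cong (_+ sum1 x L) x0≡0 ⟩
    sum1 x L
      ∎
    where open ≡-Reasoning

  module KunzCoordinates (S : NumericalSemigroup) (mult : IsMultiplicity S m) where

    N₀ : ℕ
    N₀ = proj₁ (cofinite S)

    inClass : ℕ → ℕ → Bool
    inClass r q = mem S (r + q * m)

    inClass-N₀ : ∀ r → inClass r N₀ ≡ true
    inClass-N₀ r = proj₂ (cofinite S) (r + N₀ * m) (≤-trans (m≤m*n N₀ m) (m≤n+m _ r))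

    coord : ℕ → ℕ
    coord r = least (inClass r) N₀

    coord-spec : ∀ r → inClass r (coord r) ≡ true × (∀ q → q < coord r → inClass r q ≡ false)
    coord-spec r = least-spec (inClass r) N₀ (inClass-N₀ r)

    multiple∈ : ∀ q → mem S (q * m) ≡ true
    multiple∈ zero    = zero-mem S
    multiple∈ (suc q) = closed S m (q * m) (proj₁ (proj₂ mult)) (multiple∈ q)

    vec : Vec ℕ L
    vec = tabulate1 coord L

    x : ℕ → ℕ
    x = at vec

    x0≡0 : x 0 ≡ 0
    x0≡0 = at-0 vec

    mem-decomp : ∀ r q → r < m → mem S (r + q * m) ≡ (x r ≤ᵇ q)
    mem-decomp zero    q _ = trans (multiple∈ q) (sym (cong (_≤ᵇ q) x0≡0))
    mem-decomp (suc r) q (s≤s r<L) rewrite at-tabulate1 coord L (suc r) (s≤s z≤n) r<L with coord (suc r) ℕ.≤? q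
    ... | yes c≤q =
      trans (cong (mem S) split)
            (trans (closed S _ _ (proj₁ (coord-spec (suc r))) (multiple∈ (q ∸ c))) (sym (≤ᵇ-true c q c≤q)))
      where
      c : ℕ
      c = coord (suc r)
      split : suc r + q * m ≡ suc r + c * m + (q ∸ c) * m
      split = trans (cong (λ z → suc r + z * m) (sym (m+[n∸m]≡n c≤q))) (distrib (suc r) c (q ∸ c) m)
        where
        distrib : ∀ r a b m → r + (a + b) * m ≡ r + a * m + b * m
        distrib = solve-∀
    ... | no c≰q = trans (proj₂ (coord-spec (suc r)) q (≰⇒> c≰q)) (sym (≤ᵇ-false (coord (suc r)) q (≰⇒> c≰q)))

    coord-unique : ∀ r c → inClass r c ≡ true → (∀ q → q < c → inClass r q ≡ false) → coord r ≡ c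
    coord-unique r c c∈ below = minimal-witness-unique (inClass r) _ _ (proj₁ (coord-spec r)) (proj₂ (coord-spec r)) c∈ below

    mem≡kunzMem : ∀ n → mem S n ≡ kunzMem x n
    mem≡kunzMem = ext-decomp (mem S) (kunzMem x) (λ r q r<m → trans (mem-decomp r q r<m) (sym (kunzMem-decomp x r q r<m)))

    x-positive : ∀ r → 1 ≤ r → r < m → 1 ≤ x r
    x-positive r 1≤r r<m with x r in xr
    ... | suc _ = s≤s z≤n
    ... | zero  = ⊥-elim (true≢false (begin
      true              ≡⟨ sym (≤ᵇ-true 0 0 z≤n) ⟩
      0 ≤ᵇ 0            ≡⟨ cong (_≤ᵇ 0) (sym xr) ⟩
      x r ≤ᵇ 0          ≡⟨ sym (mem-decomp r 0 r<m) ⟩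
      mem S (r + 0)     ≡⟨ cong (mem S) (+-identityʳ r) ⟩
      mem S r           ≡⟨ proj₂ (proj₂ mult) r 1≤r r<m ⟩
      false             ∎))
      where open ≡-Reasoning

    kunzInequalities : KunzInequalities x
    kunzInequalities = closed⇒KunzInequalities x (λ a b a∈ b∈ →
      trans (sym (mem≡kunzMem (a + b))) (closed S a b (trans (mem≡kunzMem a) a∈) (trans (mem≡kunzMem b) b∈)))

    x≤N₀ : ∀ r → r < m → x r ≤ N₀
    x≤N₀ r r<m = ≤ᵇ-true⇒≤ (x r) N₀ (trans (sym (mem-decomp r N₀ r<m)) (inClass-N₀ r))

    genus≡sum : ∀ g → HasGenus S g → sum1 x L ≡ g
    genus≡sum g hg = sym (begin
      g                                            ≡⟨ hasCard-unique (λ n → not (mem S n)) g (N₀ * m) hg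
                                                        (λ n le → cong not (proj₂ (cofinite S) n (≤-trans (m≤m*n N₀ m) le))) ⟩
      countBelow (λ n → not (mem S n)) (N₀ * m)    ≡⟨ countBelow-cong _ _ (N₀ * m) (λ i → cong not (mem≡kunzMem i)) ⟩
      countBelow (λ n → not (kunzMem x n)) (N₀ * m) ≡⟨ kunz-genus x N₀ x0≡0 x≤N₀ ⟩
      sum1 x L                                     ∎)
      where open ≡-Reasoning

isMinGen-+ : ∀ S a b → 1 ≤ a → 1 ≤ b → mem S a ≡ true → mem S b ≡ true → isMinGen S (a + b) ≡ false
isMinGen-+ S (suc a) (suc b) _ _ a∈ b∈
  rewrite any1-intro (λ c → mem S c ∧ mem S (suc a + suc b ∸ c)) (a + suc b) (suc a) (s≤s z≤n)
                     (subst (suc a ≤_) (sym (+-suc a b)) (s≤s (m≤m+n a b)))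
                     (∧-true a∈ (trans (cong (mem S) (m+n∸m≡n a (suc b))) b∈))
  = ∧-zeroʳ (mem S (suc (a + suc b)))

isMinGen-nonmember : ∀ S n → mem S n ≡ false → isMinGen S n ≡ false
isMinGen-nonmember S zero    _  = refl
isMinGen-nonmember S (suc n) n∉ rewrite n∉ = refl

isMinGen-intro : ∀ S n → 1 ≤ n → mem S n ≡ true →
  (∀ a → 1 ≤ a → a < n → mem S a ≡ true → mem S (n ∸ a) ≡ true → ⊥) → isMinGen S n ≡ true
isMinGen-intro S (suc n) _ n∈ indecomposable =
  cong₂ (λ u v → u ∧ not v) n∈ (any1-false _ n (λ a 1≤a a≤n →
    ∧-false (mem S a) (mem S (suc n ∸ a)) (indecomposable a 1≤a (s≤s a≤n))))

module MinimalGenerators (L : ℕ) (S : NumericalSemigroup) (x : ℕ → ℕ)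
  (mem-decomp : ∀ r q → r < suc L → mem S (r + q * suc L) ≡ (x r ≤ᵇ q))
  (x0≡0 : x 0 ≡ 0)
  (x-positive : ∀ r → 1 ≤ r → r < suc L → 1 ≤ x r)
  where
  open Kunz L using (m; m≡0+1*m; countBelow-blocks; divMod-decomp; mod<m; regroup; regroup-wrapped)

  apery : ℕ → ℕ
  apery r = r + x r * m

  member : ∀ r q → r < m → x r ≤ q → mem S (r + q * m) ≡ true
  member r q r<m xr≤q = trans (mem-decomp r q r<m) (≤ᵇ-true (x r) q xr≤q)

  nonmember : ∀ r q → r < m → q < x r → mem S (r + q * m) ≡ false
  nonmember r q r<m q<xr = trans (mem-decomp r q r<m) (≤ᵇ-false (x r) q q<xr)

  apery∈ : ∀ r → r < m → mem S (apery r) ≡ true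
  apery∈ r r<m = member r (x r) r<m ≤-refl

  m∈ : mem S m ≡ true
  m∈ = trans (cong (mem S) m≡0+1*m) (member 0 1 (s≤s z≤n) (subst (_≤ 1) (sym x0≡0) z≤n))

  member-≥m : ∀ a → 1 ≤ a → mem S a ≡ true → m ≤ a
  member-≥m a 1≤a a∈ with m ℕ.≤? a
  ... | yes m≤a = m≤a
  ... | no  m≰a = ⊥-elim (true≢false (trans (sym a∈)
                    (trans (cong (mem S) (sym (+-identityʳ a))) (nonmember a 0 (≰⇒> m≰a) (x-positive a 1≤a (≰⇒> m≰a))))))

  layer1⇒x≡1 : ∀ j → 1 ≤ j → j < m → mem S (j + 1 * m) ≡ true → x j ≡ 1
  layer1⇒x≡1 j 1≤j j<m j+m∈ =
    ≤-antisym (≤ᵇ-true⇒≤ (x j) 1 (trans (sym (mem-decomp j 1 j<m)) j+m∈)) (x-positive j 1≤j j<m)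

  m-isMinGen : isMinGen S m ≡ true
  m-isMinGen = isMinGen-intro S m (s≤s z≤n) m∈ (λ a 1≤a a<m a∈ _ →
    <⇒≱ a<m (member-≥m a 1≤a a∈))

  -- Above the Apéry element, r + q m = m + (r + (q − 1) m) with both summands in S.
  notMinGen-above : ∀ r q → r < m → x r < q → 2 ≤ q → isMinGen S (r + q * m) ≡ false
  notMinGen-above r (suc zero)    _   _ (s≤s ())
  notMinGen-above r (suc (suc q)) r<m (s≤s xr≤1+q) _ =
    trans (cong (isMinGen S) (shift r (suc q) m))
          (isMinGen-+ S m (r + suc q * m) (s≤s z≤n) (≤-trans (s≤s z≤n) (m≤n+m (suc q * m) r)) m∈ (member r (suc q) r<m xr≤1+q))
    where
    shift : ∀ r q m → r + suc q * m ≡ m + (r + q * m)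
    shift = solve-∀

  notMinGen-below : ∀ r q → r < m → q < x r → isMinGen S (r + q * m) ≡ false
  notMinGen-below r q r<m q<xr = isMinGen-nonmember S (r + q * m) (nonmember r q r<m q<xr)

  apery-isMinGen-1 : ∀ r → 1 ≤ r → r < m → x r ≡ 1 → isMinGen S (apery r) ≡ true
  apery-isMinGen-1 r 1≤r r<m xr≡1 rewrite xr≡1 = isMinGen-intro S (r + 1 * m) (≤-trans 1≤r (m≤m+n r _))
    (member r 1 r<m (≤-reflexive xr≡1)) indecomposable
    where
    indecomposable : ∀ a → 1 ≤ a → a < r + 1 * m → mem S a ≡ true → mem S (r + 1 * m ∸ a) ≡ true → ⊥
    indecomposable a 1≤a a<n a∈ b∈ = <⇒≱ n<m+m (begin
      m + m                 ≤⟨ +-mono-≤ (member-≥m a 1≤a a∈) (member-≥m _ (m<n⇒0<n∸m a<n) b∈) ⟩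
      a + (r + 1 * m ∸ a)   ≡⟨ m+[n∸m]≡n (<⇒≤ a<n) ⟩
      r + 1 * m             ∎)
      where
      open ≤-Reasoning
      n<m+m : r + 1 * m < m + m
      n<m+m = subst (λ z → r + 1 * m < m + z) (*-identityˡ m) (+-monoˡ-< (1 * m) r<m)

  apery-positive : ∀ r → 1 ≤ r → 1 ≤ apery r
  apery-positive r 1≤r = ≤-trans 1≤r (m≤m+n r (x r * m))

  apery-notMinGen-split : ∀ r j → r < m → 1 ≤ j → j < r → x j + x (r ∸ j) ≡ x r → isMinGen S (apery r) ≡ false
  apery-notMinGen-split r j r<m 1≤j j<r sum≡ =
    trans (cong (isMinGen S) apery-r≡) (isMinGen-+ S (apery j) (apery (r ∸ j))
      (apery-positive j 1≤j) (apery-positive (r ∸ j) (m<n⇒0<n∸m j<r))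
      (apery∈ j (<-trans j<r r<m)) (apery∈ (r ∸ j) (≤-<-trans (m∸n≤m r j) r<m)))
    where
    open ≡-Reasoning
    apery-r≡ : apery r ≡ apery j + apery (r ∸ j)
    apery-r≡ = begin
      r + x r * m                              ≡⟨ cong₂ (λ a b → a + b * m) (sym (m+[n∸m]≡n (<⇒≤ j<r))) (sym sum≡) ⟩
      (j + (r ∸ j)) + (x j + x (r ∸ j)) * m    ≡⟨ sym (regroup j (x j) (r ∸ j) (x (r ∸ j))) ⟩
      apery j + apery (r ∸ j)                  ∎

  apery-notMinGen-wrapped : ∀ r j k → j < m → k < m → j + k ≡ r + m → x j ≡ 1 → x k ≡ 1 → x r ≡ 3 →
    isMinGen S (apery r) ≡ false
  apery-notMinGen-wrapped r j k j<m k<m j+k≡ xj≡1 xk≡1 xr≡3 rewrite xr≡3 =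
    trans (cong (isMinGen S) apery-r≡) (isMinGen-+ S (j + 1 * m) (k + 1 * m)
      (≤-trans (s≤s z≤n) (m≤n+m (1 * m) j)) (≤-trans (s≤s z≤n) (m≤n+m (1 * m) k))
      (member j 1 j<m (≤-reflexive xj≡1)) (member k 1 k<m (≤-reflexive xk≡1)))
    where
    apery-r≡ : r + 3 * m ≡ j + 1 * m + (k + 1 * m)
    apery-r≡ = sym (regroup-wrapped j 1 k 1 r j+k≡)

  second-layer-split : ∀ r a → 1 ≤ a → a < r + 2 * m → mem S a ≡ true → mem S (r + 2 * m ∸ a) ≡ true →
    Σ ℕ λ j → j ≤ r × mem S (j + 1 * m) ≡ true × mem S ((r ∸ j) + 1 * m) ≡ true
  second-layer-split r a 1≤a a<n a∈ b∈ = j , j≤r , a∈' , b∈'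
    where
    b j : ℕ
    b = r + 2 * m ∸ a
    j = a ∸ m
    m≤a : m ≤ a
    m≤a = member-≥m a 1≤a a∈
    m≤b : m ≤ b
    m≤b = member-≥m b (m<n⇒0<n∸m a<n) b∈
    a≡ : a ≡ j + 1 * m
    a≡ = trans (sym (m∸n+n≡m m≤a)) (cong (λ z → j + z) (sym (*-identityˡ m)))
    j+b≡ : j + b ≡ r + m
    j+b≡ = +-cancelʳ-≡ m _ _ (begin
      j + b + m          ≡⟨ swap j b m ⟩
      (j + m) + b        ≡⟨ cong (_+ b) (m∸n+n≡m m≤a) ⟩
      a + b              ≡⟨ m+[n∸m]≡n (<⇒≤ a<n) ⟩
      r + 2 * m          ≡⟨ double r m ⟩
      r + m + m          ∎)
      where
      open ≡-Reasoning
      swap : ∀ j b m → j + b + m ≡ (j + m) + b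
      swap = solve-∀
      double : ∀ r m → r + 2 * m ≡ r + m + m
      double = solve-∀
    j≤r : j ≤ r
    j≤r = +-cancelʳ-≤ m j r (≤-trans (+-monoʳ-≤ j m≤b) (≤-reflexive j+b≡))
    b≡ : b ≡ (r ∸ j) + 1 * m
    b≡ = +-cancelˡ-≡ j _ _ (begin
      j + b                    ≡⟨ j+b≡ ⟩
      r + m                    ≡⟨ cong (_+ m) (sym (m+[n∸m]≡n j≤r)) ⟩
      j + (r ∸ j) + m          ≡⟨ +-assoc j (r ∸ j) m ⟩
      j + ((r ∸ j) + m)        ≡⟨ cong (λ z → j + ((r ∸ j) + z)) (sym (*-identityˡ m)) ⟩
      j + ((r ∸ j) + 1 * m)    ∎)
      where open ≡-Reasoning
    a∈' : mem S (j + 1 * m) ≡ true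
    a∈' = trans (cong (mem S) (sym a≡)) a∈
    b∈' : mem S ((r ∸ j) + 1 * m) ≡ true
    b∈' = trans (cong (mem S) (sym b≡)) b∈

  apery-isMinGen-2 : ∀ r → 1 ≤ r → r < m → x r ≡ 2 →
    (∀ j → 1 ≤ j → j < r → x j ≡ 1 → x (r ∸ j) ≡ 1 → ⊥) → isMinGen S (apery r) ≡ true
  apery-isMinGen-2 r 1≤r r<m xr≡2 no-split rewrite xr≡2 =
    isMinGen-intro S (r + 2 * m) (≤-trans 1≤r (m≤m+n r _)) (member r 2 r<m (≤-reflexive xr≡2)) indecomposable
    where
    r+m∉ : mem S (r + 1 * m) ≡ false
    r+m∉ = nonmember r 1 r<m (subst (1 <_) (sym xr≡2) ≤-refl)
    indecomposable : ∀ a → 1 ≤ a → a < r + 2 * m → mem S a ≡ true → mem S (r + 2 * m ∸ a) ≡ true → ⊥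
    indecomposable a 1≤a a<n a∈ b∈ with second-layer-split r a 1≤a a<n a∈ b∈
    ... | j , j≤r , j+m∈ , r-j+m∈ with j ℕ.≟ 0 | j ℕ.≟ r
    ...   | yes refl | _        = true≢false (trans (sym r-j+m∈) r+m∉)
    ...   | no _     | yes refl = true≢false (trans (sym j+m∈) r+m∉)
    ...   | no j≢0   | no j≢r   = no-split j (n≢0⇒n>0 j≢0) j<r
                                   (layer1⇒x≡1 j (n≢0⇒n>0 j≢0) (<-trans j<r r<m) j+m∈)
                                   (layer1⇒x≡1 (r ∸ j) (m<n⇒0<n∸m j<r) (≤-<-trans (m∸n≤m r j) r<m) r-j+m∈)
      where
      j<r : j < r
      j<r = ≤∧≢⇒< j≤r j≢r

  module _ (x≤3 : ∀ r → r < m → x r ≤ 3) where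

    minGensInClass : ℕ → ℕ
    minGensInClass r = sumBelow (λ q → indicator (isMinGen S (r + q * m))) 4

    minGensInClass-0 : minGensInClass 0 ≡ 1
    minGensInClass-0 =
      trans (sumBelow-single _ 4 1 (s≤s (s≤s z≤n)) only-m) (cong indicator (trans (cong (isMinGen S) (sym m≡0+1*m)) m-isMinGen))
      where
      only-m : ∀ q → q < 4 → q ≢ 1 → indicator (isMinGen S (0 + q * m)) ≡ 0
      only-m zero          _ _   = refl
      only-m (suc zero)    _ q≢1 = ⊥-elim (q≢1 refl)
      only-m (suc (suc q)) _ _   =
        cong indicator (notMinGen-above 0 (suc (suc q)) (s≤s z≤n) (subst (_< 2 + q) (sym x0≡0) (s≤s z≤n)) (s≤s (s≤s z≤n)))

    minGensInClass-apery : ∀ r → 1 ≤ r → r < m → minGensInClass r ≡ indicator (isMinGen S (apery r))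
    minGensInClass-apery r 1≤r r<m = sumBelow-single _ 4 (x r) (s≤s (x≤3 r r<m)) only-apery
      where
      only-apery : ∀ q → q < 4 → q ≢ x r → indicator (isMinGen S (r + q * m)) ≡ 0
      only-apery q _ q≢xr with <-cmp q (x r)
      ... | tri< q<xr _ _ = cong indicator (notMinGen-below r q r<m q<xr)
      ... | tri≈ _ q≡xr _ = ⊥-elim (q≢xr q≡xr)
      ... | tri> _ _ xr<q = cong indicator (notMinGen-above r q r<m xr<q (≤-trans (s≤s (x-positive r 1≤r r<m)) xr<q))

    countBelow-minGen : countBelow (isMinGen S) (4 * m) ≡ 1 + sum1 (λ r → indicator (isMinGen S (apery r))) L
    countBelow-minGen = begin
      countBelow (isMinGen S) (4 * m)
        ≡⟨ countBelow-blocks (isMinGen S) 4 ⟩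
      sumBelow (λ q → sumBelow (λ r → indicator (isMinGen S (r + q * m))) m) 4
        ≡⟨ sumBelow-swap (λ q r → indicator (isMinGen S (r + q * m))) 4 m ⟩
      sumBelow minGensInClass m
        ≡⟨ sumBelow-suc minGensInClass L ⟩
      minGensInClass 0 + sum1 minGensInClass L
        ≡⟨ cong₂ _+_ minGensInClass-0 (sum1-cong _ _ L (λ r 1≤r r≤L → minGensInClass-apery r 1≤r (s≤s r≤L))) ⟩
      1 + sum1 (λ r → indicator (isMinGen S (apery r))) L
        ∎
      where open ≡-Reasoning

    notMinGen-beyond : ∀ n → 4 * m ≤ n → isMinGen S n ≡ false
    notMinGen-beyond n 4m≤n = trans (cong (isMinGen S) (divMod-decomp n))
      (notMinGen-above (n % m) (n / m) (mod<m n) (≤-<-trans (x≤3 (n % m) (mod<m n)) 4≤n/m) (≤-trans (s≤s (s≤s z≤n)) 4≤n/m))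
      where
      4≤n/m : 4 ≤ n / m
      4≤n/m = subst (_≤ n / m) (m*n/n≡m 4 m) (/-monoˡ-≤ m 4m≤n)

both-one? : ℕ → ℕ → Bool
both-one? a b = (a == 1) ∧ (b == 1)

≥3-unless-both-one : ∀ a b → 1 ≤ a → 1 ≤ b → both-one? a b ≡ false → 3 ≤ a + b
≥3-unless-both-one (suc zero)    (suc zero)    _ _ ()
≥3-unless-both-one (suc zero)    (suc (suc b)) _ _ _ = s≤s (s≤s (s≤s z≤n))
≥3-unless-both-one (suc (suc a)) (suc b)       _ _ _ = s≤s (s≤s (≤-trans (s≤s z≤n) (m≤n+m (suc b) a)))

-- Genus m + k₁ with 2 k₁ + 2 ≤ m, written K = k₁ + 1

-- Fix i = i' + 1 ≤ L and write L = i + n'. The other residues pair up as j + (i − j) = i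
-- (1 ≤ j ≤ i') and as (i + l) + (i + n' + 1 − l) = i + m (1 ≤ l ≤ n'); by the Kunz inequalities
-- each pair sum is at least x i resp. x i − 1, while all of them together sum to at most 2 Σ x.
module Pairing (L K : ℕ) (x : ℕ → ℕ)
  (x-positive : ∀ r → 1 ≤ r → r < suc L → 1 ≤ x r)
  (ki : Kunz.KunzInequalities L x)
  (sum≡ : sum1 x L ≡ L + K)
  (2K≤m : 2 * K ≤ suc L)
  where
  open Kunz L using (m)

  pair-sum-bound : ∀ i' n' c c' → L ≡ suc i' + n' →
    (∀ j → 1 ≤ j → j ≤ i' → c ≤ x j + x (suc i' ∸ j)) →
    (∀ l → 1 ≤ l → l ≤ n' → c' ≤ x (suc i' + l) + x (suc i' + (suc n' ∸ l))) →
    i' * c + 2 * x (suc i') + n' * c' ≤ 2 * (L + K)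
  pair-sum-bound i' n' c c' L≡ direct wrapped = begin
    i' * c + 2 * x (suc i') + n' * c'
      ≤⟨ +-mono-≤ (+-monoˡ-≤ (2 * x (suc i')) (sum1-pairing-bound x i' c direct)) (sum1-pairing-bound f n' c' wrapped) ⟩
    2 * sum1 x i' + 2 * x (suc i') + 2 * sum1 f n'
      ≡⟨ sym (distrib (sum1 x i') (x (suc i')) (sum1 f n')) ⟩
    2 * (sum1 x i' + x (suc i') + sum1 f n')
      ≡⟨ cong (2 *_) (sym (trans (cong (sum1 x) L≡) (sum1-split x (suc i') n'))) ⟩
    2 * sum1 x L
      ≡⟨ cong (2 *_) sum≡ ⟩
    2 * (L + K)
      ∎
    where
    open ≤-Reasoning
    f : ℕ → ℕ
    f l = x (suc i' + l)
    distrib : ∀ a b c → 2 * (a + b + c) ≡ 2 * a + 2 * b + 2 * c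
    distrib = solve-∀

  index-split : ∀ i → 1 ≤ i → i ≤ L → Σ ℕ λ i' → Σ ℕ λ n' → i ≡ suc i' × L ≡ suc i' + n'
  index-split (suc i') _ i≤L = i' , L ∸ suc i' , refl , sym (m+[n∸m]≡n i≤L)

  direct-pair : ∀ i' j → suc i' ≤ L → 1 ≤ j → j ≤ i' → x (suc i') ≤ x j + x (suc i' ∸ j)
  direct-pair i' j i≤L _ j≤i' =
    subst (λ z → x z ≤ x j + x (suc i' ∸ j)) j+k≡i (proj₁ (ki j (suc i' ∸ j) j<m k<m) (subst (_< m) (sym j+k≡i) (s≤s i≤L)))
    where
    j+k≡i : j + (suc i' ∸ j) ≡ suc i'
    j+k≡i = m+[n∸m]≡n (≤-trans j≤i' (n≤1+n i'))
    j<m : j < m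
    j<m = s≤s (≤-trans (≤-trans j≤i' (n≤1+n i')) i≤L)
    k<m : suc i' ∸ j < m
    k<m = s≤s (≤-trans (m∸n≤m (suc i') j) i≤L)

  wrapped-pair-indices : ∀ i' n' → L ≡ suc i' + n' → ∀ l → 1 ≤ l → l ≤ n' →
    suc i' + l < m × suc i' + (suc n' ∸ l) < m × (suc i' + l) + (suc i' + (suc n' ∸ l)) ≡ suc i' + m
  wrapped-pair-indices i' n' L≡ (suc l') _ l≤n' =
      s≤s (subst (suc i' + suc l' ≤_) (sym L≡) (+-monoʳ-≤ (suc i') l≤n'))
    , s≤s (subst (suc i' + (n' ∸ l') ≤_) (sym L≡) (+-monoʳ-≤ (suc i') (m∸n≤m n' l')))
    , (begin
      (i + suc l') + (i + (n' ∸ l'))   ≡⟨ regroup i (suc l') (n' ∸ l') ⟩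
      i + (i + (suc l' + (n' ∸ l')))   ≡⟨ cong (λ z → i + (i + z)) (m+[n∸m]≡n (m≤n⇒m≤1+n l≤n')) ⟩
      i + (i + suc n')                 ≡⟨ cong (λ z → i + z) (trans (+-suc i n') (cong suc (sym L≡))) ⟩
      i + m                            ∎)
    where
    open ≡-Reasoning
    i : ℕ
    i = suc i'
    regroup : ∀ i a b → (i + a) + (i + b) ≡ i + (i + (a + b))
    regroup = solve-∀

  wrapped-pair : ∀ i' n' → L ≡ suc i' + n' → ∀ l → 1 ≤ l → l ≤ n' →
    x (suc i') ≤ suc (x (suc i' + l) + x (suc i' + (suc n' ∸ l)))
  wrapped-pair i' n' L≡ l 1≤l l≤n' with wrapped-pair-indices i' n' L≡ l 1≤l l≤n'
  ... | j<m , k<m , j+k≡ =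
    subst (λ z → x z ≤ suc (x (suc i' + l) + x (suc i' + (suc n' ∸ l)))) (trans (cong (_∸ m) j+k≡) (m+n∸n≡m (suc i') m))
          (proj₂ (ki _ _ j<m k<m) (subst (m ≤_) (sym j+k≡) (m≤n+m m (suc i'))))

  pairs-4-3-bound : ∀ i' n' → L ≡ suc i' + n' →
    (∀ j → 1 ≤ j → j ≤ i' → 4 ≤ x j + x (suc i' ∸ j)) →
    (∀ l → 1 ≤ l → l ≤ n' → 3 ≤ x (suc i' + l) + x (suc i' + (suc n' ∸ l))) →
    i' + 2 * x (suc i') ≤ 4
  pairs-4-3-bound i' n' L≡ direct wrapped = +-cancelˡ-≤ (3 * i' + 3 * n') _ _ (begin
    3 * i' + 3 * n' + (i' + 2 * x (suc i'))   ≡⟨ lhs i' n' (x (suc i')) ⟩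
    i' * 4 + 2 * x (suc i') + n' * 3          ≤⟨ pair-sum-bound i' n' 4 3 L≡ direct wrapped ⟩
    2 * (L + K)                               ≡⟨ *-distribˡ-+ 2 L K ⟩
    2 * L + 2 * K                             ≤⟨ +-monoʳ-≤ (2 * L) 2K≤m ⟩
    2 * L + suc L                             ≡⟨ cong (λ l → 2 * l + suc l) L≡ ⟩
    2 * (suc i' + n') + suc (suc i' + n')     ≡⟨ rhs i' n' ⟩
    3 * i' + 3 * n' + 4                       ∎)
    where
    open ≤-Reasoning
    lhs : ∀ i' n' X → 3 * i' + 3 * n' + (i' + 2 * X) ≡ i' * 4 + 2 * X + n' * 3
    lhs = solve-∀
    rhs : ∀ i' n' → 2 * (suc i' + n') + suc (suc i' + n') ≡ 3 * i' + 3 * n' + 4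
    rhs = solve-∀

  pairs-3-2-bound : ∀ i' n' → L ≡ suc i' + n' →
    (∀ j → 1 ≤ j → j ≤ i' → 3 ≤ x j + x (suc i' ∸ j)) →
    (∀ l → 1 ≤ l → l ≤ n' → 2 ≤ x (suc i' + l) + x (suc i' + (suc n' ∸ l))) →
    i' + 2 * x (suc i') ≤ 2 + 2 * K
  pairs-3-2-bound i' n' L≡ direct wrapped = +-cancelˡ-≤ (2 * i' + 2 * n') _ _ (begin
    2 * i' + 2 * n' + (i' + 2 * x (suc i'))   ≡⟨ lhs i' n' (x (suc i')) ⟩
    i' * 3 + 2 * x (suc i') + n' * 2          ≤⟨ pair-sum-bound i' n' 3 2 L≡ direct wrapped ⟩
    2 * (L + K)                               ≡⟨ cong (λ l → 2 * (l + K)) L≡ ⟩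
    2 * (suc i' + n' + K)                     ≡⟨ rhs i' n' K ⟩
    2 * i' + 2 * n' + (2 + 2 * K)             ∎)
    where
    open ≤-Reasoning
    lhs : ∀ i' n' X → 2 * i' + 2 * n' + (i' + 2 * X) ≡ i' * 3 + 2 * X + n' * 2
    lhs = solve-∀
    rhs : ∀ i' n' K → 2 * (suc i' + n' + K) ≡ 2 * i' + 2 * n' + (2 + 2 * K)
    rhs = solve-∀

  wrapped-x-positive : ∀ i' n' → L ≡ suc i' + n' → ∀ l → 1 ≤ l → l ≤ n' →
    1 ≤ x (suc i' + l) × 1 ≤ x (suc i' + (suc n' ∸ l))
  wrapped-x-positive i' n' L≡ l 1≤l l≤n' with wrapped-pair-indices i' n' L≡ l 1≤l l≤n'
  ... | j<m , k<m , _ = x-positive _ (s≤s z≤n) j<m , x-positive _ (s≤s z≤n) k<m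

  x≤3 : ∀ i → 1 ≤ i → i ≤ L → x i ≤ 3
  x≤3 i 1≤i i≤L with index-split i 1≤i i≤L
  ... | i' , n' , refl , L≡ with x (suc i') ℕ.≤? 3
  ...   | yes x≤3 = x≤3
  ...   | no  x≰3 = ⊥-elim (<⇒≱ (s≤s (s≤s (s≤s (s≤s (s≤s z≤n))))) (begin
    8                     ≤⟨ *-monoʳ-≤ 2 4≤x ⟩
    2 * x (suc i')        ≤⟨ m≤n+m _ i' ⟩
    i' + 2 * x (suc i')   ≤⟨ pairs-4-3-bound i' n' L≡ (λ j 1≤j j≤i' → ≤-trans 4≤x (direct-pair i' j i≤L 1≤j j≤i'))
                                               (λ l 1≤l l≤n' → ≤-pred (≤-trans 4≤x (wrapped-pair i' n' L≡ l 1≤l l≤n'))) ⟩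
    4                     ∎))
    where
    open ≤-Reasoning
    4≤x : 4 ≤ x (suc i')
    4≤x = ≰⇒> x≰3

  x≡3⇒i+3≤2K : ∀ i → 1 ≤ i → i ≤ L → x i ≡ 3 → i + 3 ≤ 2 * K
  x≡3⇒i+3≤2K i 1≤i i≤L xi≡3 with index-split i 1≤i i≤L
  ... | i' , n' , refl , L≡ = +-cancelˡ-≤ 2 _ _ (begin
    2 + (suc i' + 3)      ≡⟨ shuffle i' ⟩
    i' + 2 * 3            ≡⟨ cong (λ v → i' + 2 * v) (sym xi≡3) ⟩
    i' + 2 * x (suc i')   ≤⟨ pairs-3-2-bound i' n' L≡ (λ j 1≤j j≤i' → ≤-trans 3≤x (direct-pair i' j i≤L 1≤j j≤i'))
                                               (λ l 1≤l l≤n' → ≤-pred (≤-trans 3≤x (wrapped-pair i' n' L≡ l 1≤l l≤n'))) ⟩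
    2 + 2 * K             ∎)
    where
    open ≤-Reasoning
    3≤x : 3 ≤ x (suc i')
    3≤x = ≤-reflexive (sym xi≡3)
    shuffle : ∀ i' → 2 + (suc i' + 3) ≡ i' + 2 * 3
    shuffle = solve-∀

  data ThreeSplit (i : ℕ) : Set where
    direct  : ∀ j → 1 ≤ j → j < i → x j + x (i ∸ j) ≡ 3 → ThreeSplit i
    wrapped : ∀ j k → j < m → k < m → j + k ≡ i + m → x j ≡ 1 → x k ≡ 1 → ThreeSplit i

  x≡3⇒split : ∀ i → 1 ≤ i → i ≤ L → x i ≡ 3 → ThreeSplit i
  x≡3⇒split i 1≤i i≤L xi≡3 with index-split i 1≤i i≤L
  ... | i' , n' , refl , L≡ with bool-dec (any1 sums-to-3 i') | bool-dec (any1 wrapped-ones n')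
    where
    sums-to-3 wrapped-ones : ℕ → Bool
    sums-to-3 j = (x j + x (suc i' ∸ j)) == 3
    wrapped-ones l = both-one? (x (suc i' + l)) (x (suc i' + (suc n' ∸ l)))
  ...   | inj₁ found | _ with any1-true⇒ _ i' found
  ...     | j , 1≤j , j≤i' , sum≡3 = direct j 1≤j (s≤s j≤i') (==-true⇒≡ _ _ sum≡3)
  x≡3⇒split i 1≤i i≤L xi≡3 | i' , n' , refl , L≡ | inj₂ _ | inj₁ found with any1-true⇒ _ n' found
  ...     | l , 1≤l , l≤n' , ones with wrapped-pair-indices i' n' L≡ l 1≤l l≤n'
  ...       | j<m , k<m , j+k≡ =
    wrapped _ _ j<m k<m j+k≡ (==-true⇒≡ _ _ (∧-conicalˡ _ _ ones)) (==-true⇒≡ _ _ (∧-conicalʳ _ _ ones))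
  x≡3⇒split i 1≤i i≤L xi≡3 | i' , n' , refl , L≡ | inj₂ no-direct | inj₂ no-wrapped =
    ⊥-elim (<⇒≱ (s≤s (s≤s (s≤s (s≤s (s≤s z≤n))))) (begin
      6                     ≡⟨ cong (2 *_) (sym xi≡3) ⟩
      2 * x (suc i')        ≤⟨ m≤n+m _ i' ⟩
      i' + 2 * x (suc i')   ≤⟨ pairs-4-3-bound i' n' L≡ direct≥4 wrapped≥3 ⟩
      4                     ∎))
    where
    open ≤-Reasoning
    direct≥4 : ∀ j → 1 ≤ j → j ≤ i' → 4 ≤ x j + x (suc i' ∸ j)
    direct≥4 j 1≤j j≤i' with m≤n⇒m<n∨m≡n (≤-trans (≤-reflexive (sym xi≡3)) (direct-pair i' j i≤L 1≤j j≤i'))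
    ... | inj₁ 3<sum  = 3<sum
    ... | inj₂ 3≡sum = ⊥-elim (==-false⇒≢ _ _ (any1-false⇒ _ i' no-direct j 1≤j j≤i') (sym 3≡sum))
    wrapped≥3 : ∀ l → 1 ≤ l → l ≤ n' → 3 ≤ x (suc i' + l) + x (suc i' + (suc n' ∸ l))
    wrapped≥3 l 1≤l l≤n' = ≥3-unless-both-one _ _
      (proj₁ (wrapped-x-positive i' n' L≡ l 1≤l l≤n')) (proj₂ (wrapped-x-positive i' n' L≡ l 1≤l l≤n'))
      (any1-false⇒ _ n' no-wrapped l 1≤l l≤n')

  x≡2⇒split : ∀ i → 1 ≤ i → i ≤ L → x i ≡ 2 → 2 * K ≤ i →
    Σ ℕ λ j → 1 ≤ j × j < i × x j ≡ 1 × x (i ∸ j) ≡ 1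
  x≡2⇒split i 1≤i i≤L xi≡2 2K≤i with index-split i 1≤i i≤L
  ... | i' , n' , refl , L≡ with bool-dec (any1 (λ j → both-one? (x j) (x (suc i' ∸ j))) i')
  ...   | inj₁ found with any1-true⇒ _ i' found
  ...     | j , 1≤j , j≤i' , ones = j , 1≤j , s≤s j≤i' , ==-true⇒≡ _ _ (∧-conicalˡ _ _ ones) , ==-true⇒≡ _ _ (∧-conicalʳ _ _ ones)
  x≡2⇒split i 1≤i i≤L xi≡2 2K≤i | i' , n' , refl , L≡ | inj₂ none =
    ⊥-elim (<⇒≱ (≤-reflexive (shuffle i')) (begin
      i' + 4               ≡⟨ cong (λ v → i' + 2 * v) (sym xi≡2) ⟩
      i' + 2 * x (suc i')  ≤⟨ pairs-3-2-bound i' n' L≡ direct≥3 wrapped≥2 ⟩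
      2 + 2 * K            ≤⟨ +-monoʳ-≤ 2 2K≤i ⟩
      2 + suc i'           ∎))
    where
    open ≤-Reasoning
    shuffle : ∀ i' → suc (2 + suc i') ≡ i' + 4
    shuffle = solve-∀
    direct≥3 : ∀ j → 1 ≤ j → j ≤ i' → 3 ≤ x j + x (suc i' ∸ j)
    direct≥3 j 1≤j j≤i' = ≥3-unless-both-one _ _
      (x-positive j 1≤j (s≤s (≤-trans j≤i' (≤-trans (n≤1+n i') i≤L))))
      (x-positive (suc i' ∸ j) (m<n⇒0<n∸m (s≤s j≤i')) (s≤s (≤-trans (m∸n≤m (suc i') j) i≤L)))
      (any1-false⇒ _ i' none j 1≤j j≤i')
    wrapped≥2 : ∀ l → 1 ≤ l → l ≤ n' → 2 ≤ x (suc i' + l) + x (suc i' + (suc n' ∸ l))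
    wrapped≥2 l 1≤l l≤n' = +-mono-≤ (proj₁ (wrapped-x-positive i' n' L≡ l 1≤l l≤n')) (proj₂ (wrapped-x-positive i' n' L≡ l 1≤l l≤n'))

-- The statistics a, b, c of x̄ = (x₁, …, x_t), t = 2K − 1, and the count d of condition (4)

cong-+⁴ : ∀ {a b c d a' b' c' d'} → a ≡ a' → b ≡ b' → c ≡ c' → d ≡ d' → a + b + c + d ≡ a' + b' + c' + d'
cong-+⁴ refl refl refl refl = refl

indicator-∧ˡ : ∀ a b → a ≡ false → indicator (a ∧ b) ≡ 0
indicator-∧ˡ a b refl = refl

indicator-∧ʳ : ∀ a b → b ≡ false → indicator (a ∧ b) ≡ 0
indicator-∧ʳ a b refl rewrite ∧-zeroʳ a = refl

indicator-∧-true : ∀ a b → a ≡ true → b ≡ true → indicator (a ∧ b) ≡ 1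
indicator-∧-true a b refl refl = refl

sum1-below : ∀ (P : ℕ → Bool) t L → t ≤ L → sum1 (λ r → indicator ((r ≤ᵇ t) ∧ P r)) L ≡ count1 P t
sum1-below P t L t≤L = begin
  sum1 f L                          ≡⟨ cong (sum1 f) (sym (m+[n∸m]≡n t≤L)) ⟩
  sum1 f (t + (L ∸ t))              ≡⟨ sum1-vanishing-tail f t (L ∸ t) (λ i t<i _ → indicator-∧ˡ _ (P i) (≤ᵇ-false i t t<i)) ⟩
  sum1 f t                          ≡⟨ sum1-cong _ _ t (λ i _ i≤t → cong (λ b → indicator (b ∧ P i)) (≤ᵇ-true i t i≤t)) ⟩
  sum1 (λ r → indicator (P r)) t    ≡⟨ sym (count1≡sum1 P t) ⟩
  count1 P t                        ∎
  where
  open ≡-Reasoning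
  f : ℕ → ℕ
  f r = indicator ((r ≤ᵇ t) ∧ P r)

n≤suc[n∸1] : ∀ n → n ≤ suc (n ∸ 1)
n≤suc[n∸1] zero    = z≤n
n≤suc[n∸1] (suc n) = ≤-refl

≤∸1⇒< : ∀ r n → 1 ≤ r → r ≤ n ∸ 1 → r < n
≤∸1⇒< (suc r) (suc n) _ r≤n = s≤s r≤n

<⇒≤∸1 : ∀ {j r} → j < r → j ≤ r ∸ 1
<⇒≤∸1 (s≤s j≤r) = j≤r

module Statistics (L K : ℕ) (x : ℕ → ℕ) where

  t : ℕ
  t = 2 * K ∸ 1

  inC : ℕ → Bool
  inC r = any1 (λ j₁ → any1 (λ j₂ → ((j₁ + j₂) == r) ∧ (x j₁ == 1) ∧ (x j₂ == 1) ∧ (x r == 2)) t) t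

  aTerm bTerm cTerm dTerm : ℕ → ℕ
  aTerm r = indicator ((r ≤ᵇ t) ∧ (x r == 2))
  bTerm r = indicator ((r ≤ᵇ t) ∧ (x r == 3))
  cTerm r = indicator ((r ≤ᵇ t) ∧ inC r)
  dTerm r = indicator ((2 * K ≤ᵇ r) ∧ (x r == 2))

  r<2K⇒r≤t : ∀ r → suc r ≤ 2 * K → r ≤ t
  r<2K⇒r≤t r r<2K = ∸-monoˡ-≤ 1 r<2K

  d : ℕ
  d = count1 (λ r → (2 * K ≤ᵇ r) ∧ (x r == 2)) L

  inC-false : ∀ r → x r ≢ 2 → inC r ≡ false
  inC-false r xr≢2 = any1-false _ t (λ j₁ _ _ → any1-false _ t (λ j₂ _ _ → not-two j₁ j₂))
    where
    not-two : ∀ j₁ j₂ → (((j₁ + j₂) == r) ∧ (x j₁ == 1) ∧ (x j₂ == 1) ∧ (x r == 2)) ≡ false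
    not-two j₁ j₂ rewrite ==-false (x r) 2 xr≢2 | ∧-zeroʳ (x j₂ == 1) | ∧-zeroʳ (x j₁ == 1) = ∧-zeroʳ ((j₁ + j₂) == r)

  inC-intro : ∀ r j → r ≤ t → x r ≡ 2 → 1 ≤ j → j < r → x j ≡ 1 → x (r ∸ j) ≡ 1 → inC r ≡ true
  inC-intro r j r≤t xr≡2 1≤j j<r xj≡1 xk≡1 =
    any1-intro _ t j 1≤j (≤-trans (<⇒≤ j<r) r≤t) (any1-intro _ t (r ∸ j) (m<n⇒0<n∸m j<r) (≤-trans (m∸n≤m r j) r≤t)
      (∧-true (==-true _ _ (m+[n∸m]≡n (<⇒≤ j<r))) (∧-true (==-true _ _ xj≡1) (∧-true (==-true _ _ xk≡1) (==-true _ _ xr≡2)))))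

  inC-false-unsplit : ∀ r → (∀ j → 1 ≤ j → j < r → x j ≡ 1 → x (r ∸ j) ≡ 1 → ⊥) → inC r ≡ false
  inC-false-unsplit r no-split = any1-false _ t (λ j₁ 1≤j₁ _ → any1-false _ t (λ j₂ 1≤j₂ _ → unsplit j₁ j₂ 1≤j₁ 1≤j₂))
    where
    unsplit : ∀ j₁ j₂ → 1 ≤ j₁ → 1 ≤ j₂ → (((j₁ + j₂) == r) ∧ (x j₁ == 1) ∧ (x j₂ == 1) ∧ (x r == 2)) ≡ false
    unsplit j₁ j₂ 1≤j₁ 1≤j₂ with (j₁ + j₂) == r in sum≡ | x j₁ == 1 in xj₁≡1 | x j₂ == 1 in xj₂≡1
    ... | false | _     | _     = refl
    ... | true  | false | _     = refl
    ... | true  | true  | false = refl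
    ... | true  | true  | true  = ⊥-elim (no-split j₁ 1≤j₁ j₁<r (==-true⇒≡ _ _ xj₁≡1) (trans (cong x r-j₁≡j₂) (==-true⇒≡ _ _ xj₂≡1)))
      where
      j₁+j₂≡r : j₁ + j₂ ≡ r
      j₁+j₂≡r = ==-true⇒≡ _ _ sum≡
      r-j₁≡j₂ : r ∸ j₁ ≡ j₂
      r-j₁≡j₂ = trans (cong (_∸ j₁) (sym j₁+j₂≡r)) (m+n∸m≡n j₁ j₂)
      j₁<r : j₁ < r
      j₁<r = subst (j₁ <_) j₁+j₂≡r (subst (_≤ j₁ + j₂) (+-comm j₁ 1) (+-monoʳ-≤ j₁ 1≤j₂))

  module _ (x∈123 : ∀ r → 1 ≤ r → r ≤ L → x r ≡ 1 ⊎ x r ≡ 2 ⊎ x r ≡ 3)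
           (x≡3⇒r<2K : ∀ r → 1 ≤ r → r ≤ L → x r ≡ 3 → suc r ≤ 2 * K)
           (t≤L : t ≤ L)
    where

    x-decomposition : ∀ r → 1 ≤ r → r ≤ L → x r ≡ 1 + (aTerm r + dTerm r) + 2 * bTerm r
    x-decomposition r 1≤r r≤L with x∈123 r 1≤r r≤L
    ... | inj₁ xr≡1 rewrite xr≡1 | ∧-zeroʳ (r ≤ᵇ t) | ∧-zeroʳ (2 * K ≤ᵇ r) = refl
    ... | inj₂ (inj₂ xr≡3) rewrite xr≡3 | ∧-zeroʳ (2 * K ≤ᵇ r) | ≤ᵇ-true r t (r<2K⇒r≤t r (x≡3⇒r<2K r 1≤r r≤L xr≡3)) = refl
    ... | inj₂ (inj₁ xr≡2) rewrite xr≡2 | ∧-zeroʳ (r ≤ᵇ t) with r ℕ.≤? t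
    ...   | yes r≤t rewrite ≤ᵇ-true r t r≤t | ≤ᵇ-false (2 * K) r (≤∸1⇒< r (2 * K) 1≤r r≤t) = refl
    ...   | no  r≰t rewrite ≤ᵇ-false r t (≰⇒> r≰t) | ≤ᵇ-true (2 * K) r (≤-trans (n≤suc[n∸1] (2 * K)) (≰⇒> r≰t)) = refl

    sum-x≡ : sum1 x L ≡ L + (aOf t x + d) + 2 * bOf t x
    sum-x≡ = begin
      sum1 x L
        ≡⟨ sum1-cong _ _ L x-decomposition ⟩
      sum1 (λ r → 1 + (aTerm r + dTerm r) + 2 * bTerm r) L
        ≡⟨ sum1-+ (λ r → 1 + (aTerm r + dTerm r)) (λ r → 2 * bTerm r) L ⟩
      sum1 (λ r → 1 + (aTerm r + dTerm r)) L + sum1 (λ r → 2 * bTerm r) L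
        ≡⟨ cong₂ _+_ (sum1-+ (λ _ → 1) (λ r → aTerm r + dTerm r) L) (sumBelow-*ˡ 2 (λ r → bTerm (suc r)) L) ⟩
      sum1 (λ _ → 1) L + sum1 (λ r → aTerm r + dTerm r) L + 2 * sum1 bTerm L
        ≡⟨ cong₂ (λ u v → u + v + 2 * sum1 bTerm L) (trans (sum1-const 1 L) (*-identityʳ L)) (sum1-+ aTerm dTerm L) ⟩
      L + (sum1 aTerm L + sum1 dTerm L) + 2 * sum1 bTerm L
        ≡⟨ cong₂ (λ u v → L + (u + sum1 dTerm L) + 2 * v) (sum1-below (λ r → x r == 2) t L t≤L) (sum1-below (λ r → x r == 3) t L t≤L) ⟩
      L + (aOf t x + sum1 dTerm L) + 2 * bOf t x
        ≡⟨ cong (λ u → L + (aOf t x + u) + 2 * bOf t x) (sym (count1≡sum1 _ L)) ⟩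
      L + (aOf t x + d) + 2 * bOf t x
        ∎
      where open ≡-Reasoning

module EmbeddingDimension (L K : ℕ) (S : NumericalSemigroup) (x : ℕ → ℕ)
  (mem-decomp : ∀ r q → r < suc L → mem S (r + q * suc L) ≡ (x r ≤ᵇ q))
  (x0≡0 : x 0 ≡ 0)
  (x-positive : ∀ r → 1 ≤ r → r < suc L → 1 ≤ x r)
  (ki : Kunz.KunzInequalities L x)
  (sum≡ : sum1 x L ≡ L + K)
  (2K≤m : 2 * K ≤ suc L)
  where
  open Kunz L using (m)
  open Pairing L K x x-positive ki sum≡ 2K≤m public
  open MinimalGenerators L S x mem-decomp x0≡0 x-positive public
  open Statistics L K x public

  t≤L : t ≤ L
  t≤L = ∸-monoˡ-≤ 1 2K≤m

  x<m⇒x≤3 : ∀ r → r < m → x r ≤ 3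
  x<m⇒x≤3 zero    _         = subst (_≤ 3) (sym x0≡0) z≤n
  x<m⇒x≤3 (suc r) (s≤s r<L) = x≤3 (suc r) (s≤s z≤n) r<L

  x∈123 : ∀ r → 1 ≤ r → r ≤ L → x r ≡ 1 ⊎ x r ≡ 2 ⊎ x r ≡ 3
  x∈123 r 1≤r r≤L = between (x r) (x-positive r 1≤r (s≤s r≤L)) (x≤3 r 1≤r r≤L)
    where
    between : ∀ v → 1 ≤ v → v ≤ 3 → v ≡ 1 ⊎ v ≡ 2 ⊎ v ≡ 3
    between 1 _ _ = inj₁ refl
    between 2 _ _ = inj₂ (inj₁ refl)
    between 3 _ _ = inj₂ (inj₂ refl)
    between (suc (suc (suc (suc _)))) _ (s≤s (s≤s (s≤s ())))

  x≡3⇒r<2K : ∀ r → 1 ≤ r → r ≤ L → x r ≡ 3 → suc r ≤ 2 * K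
  x≡3⇒r<2K r 1≤r r≤L xr≡3 = ≤-trans (s≤s (m≤m+n r 2)) (subst (_≤ 2 * K) (+-suc r 2) (x≡3⇒i+3≤2K r 1≤r r≤L xr≡3))

  minGenTerm : ℕ → ℕ
  minGenTerm r = indicator (isMinGen S (apery r))

  counted-once : ∀ r → 1 ≤ r → r ≤ L → minGenTerm r + bTerm r + cTerm r + dTerm r ≡ 1
  counted-once r 1≤r r≤L with x∈123 r 1≤r r≤L
  ... | inj₁ xr≡1 = cong-+⁴ {d' = 0}
    (cong indicator (apery-isMinGen-1 r 1≤r (s≤s r≤L) xr≡1))
    (indicator-∧ʳ _ _ (==-false _ _ (λ xr≡3 → 1≢3 (trans (sym xr≡1) xr≡3))))
    (indicator-∧ʳ _ _ (inC-false r (λ xr≡2 → 1≢2 (trans (sym xr≡1) xr≡2))))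
    (indicator-∧ʳ _ _ (==-false _ _ (λ xr≡2 → 1≢2 (trans (sym xr≡1) xr≡2))))
    where
    1≢2 : 1 ≢ 2
    1≢2 ()
    1≢3 : 1 ≢ 3
    1≢3 ()
  ... | inj₂ (inj₂ xr≡3) = cong-+⁴ {a' = 0} {b' = 1} {c' = 0} {d' = 0}
    (cong indicator not-minGen)
    (indicator-∧-true _ _ (≤ᵇ-true r t (r<2K⇒r≤t r (x≡3⇒r<2K r 1≤r r≤L xr≡3))) (==-true _ _ xr≡3))
    (indicator-∧ʳ _ _ (inC-false r 3≢2))
    (indicator-∧ʳ _ _ (==-false _ _ 3≢2))
    where
    3≢2 : x r ≢ 2
    3≢2 xr≡2 with trans (sym xr≡3) xr≡2
    ... | ()
    not-minGen : isMinGen S (apery r) ≡ false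
    not-minGen with x≡3⇒split r 1≤r r≤L xr≡3
    ... | direct j 1≤j j<r sum≡3        = apery-notMinGen-split r j (s≤s r≤L) 1≤j j<r (trans sum≡3 (sym xr≡3))
    ... | wrapped j k j<m k<m j+k≡ xj xk = apery-notMinGen-wrapped r j k j<m k<m j+k≡ xj xk xr≡3
  ... | inj₂ (inj₁ xr≡2) with r ℕ.≤? t
  ...   | no r≰t with x≡2⇒split r 1≤r r≤L xr≡2 (≤-trans (n≤suc[n∸1] (2 * K)) (≰⇒> r≰t))
  ...     | j , 1≤j , j<r , xj≡1 , xk≡1 = cong-+⁴ {a' = 0} {b' = 0} {c' = 0} {d' = 1}
    (cong indicator (apery-notMinGen-split r j (s≤s r≤L) 1≤j j<r (trans (cong₂ _+_ xj≡1 xk≡1) (sym xr≡2))))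
    (indicator-∧ˡ _ _ (≤ᵇ-false r t (≰⇒> r≰t)))
    (indicator-∧ˡ _ _ (≤ᵇ-false r t (≰⇒> r≰t)))
    (indicator-∧-true _ _ (≤ᵇ-true (2 * K) r (≤-trans (n≤suc[n∸1] (2 * K)) (≰⇒> r≰t))) (==-true _ _ xr≡2))
  counted-once r 1≤r r≤L | inj₂ (inj₁ xr≡2) | yes r≤t
    with bool-dec (any1 (λ j → both-one? (x j) (x (r ∸ j))) (r ∸ 1))
  ... | inj₁ found with any1-true⇒ _ (r ∸ 1) found
  ...   | j , 1≤j , j≤r-1 , ones = cong-+⁴ {a' = 0} {b' = 0} {c' = 1} {d' = 0}
    (cong indicator (apery-notMinGen-split r j (s≤s r≤L) 1≤j j<r (trans (cong₂ _+_ xj≡1 xk≡1) (sym xr≡2))))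
    (indicator-∧ʳ _ _ (==-false _ _ 2≢3))
    (indicator-∧-true _ _ (≤ᵇ-true r t r≤t) (inC-intro r j r≤t xr≡2 1≤j j<r xj≡1 xk≡1))
    (indicator-∧ˡ _ _ (≤ᵇ-false (2 * K) r (≤∸1⇒< r (2 * K) 1≤r r≤t)))
    where
    j<r : j < r
    j<r = ≤∸1⇒< j r 1≤j j≤r-1
    xj≡1 : x j ≡ 1
    xj≡1 = ==-true⇒≡ _ _ (∧-conicalˡ _ _ ones)
    xk≡1 : x (r ∸ j) ≡ 1
    xk≡1 = ==-true⇒≡ _ _ (∧-conicalʳ _ _ ones)
    2≢3 : x r ≢ 3
    2≢3 xr≡3 with trans (sym xr≡2) xr≡3
    ... | ()
  counted-once r 1≤r r≤L | inj₂ (inj₁ xr≡2) | yes r≤t | inj₂ none = cong-+⁴ {a' = 1} {b' = 0} {c' = 0} {d' = 0}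
    (cong indicator (apery-isMinGen-2 r 1≤r (s≤s r≤L) xr≡2 no-split))
    (indicator-∧ʳ _ _ (==-false _ _ 2≢3))
    (indicator-∧ʳ _ _ (inC-false-unsplit r no-split))
    (indicator-∧ˡ _ _ (≤ᵇ-false (2 * K) r (≤∸1⇒< r (2 * K) 1≤r r≤t)))
    where
    no-split : ∀ j → 1 ≤ j → j < r → x j ≡ 1 → x (r ∸ j) ≡ 1 → ⊥
    no-split j 1≤j j<r xj≡1 xk≡1 = true≢false (trans (sym (∧-true (==-true _ _ xj≡1) (==-true _ _ xk≡1)))
                                                     (any1-false⇒ _ (r ∸ 1) none j 1≤j (<⇒≤∸1 j<r)))
    2≢3 : x r ≢ 3
    2≢3 xr≡3 with trans (sym xr≡2) xr≡3
    ... | ()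

  minGen-identity : countBelow (isMinGen S) (4 * m) + bOf t x + cOf t x + d ≡ m
  minGen-identity = begin
    countBelow (isMinGen S) (4 * m) + bOf t x + cOf t x + d
      ≡⟨ cong-+⁴ (countBelow-minGen x<m⇒x≤3) (sym (sum1-below (λ r → x r == 3) t L t≤L))
                 (sym (sum1-below inC t L t≤L)) (count1≡sum1 _ L) ⟩
    1 + sum1 minGenTerm L + sum1 bTerm L + sum1 cTerm L + sum1 dTerm L
      ≡⟨ cong suc (sym (trans (sum1-+ (λ r → minGenTerm r + bTerm r + cTerm r) dTerm L)
                         (cong (_+ sum1 dTerm L) (trans (sum1-+ (λ r → minGenTerm r + bTerm r) cTerm L)
                                                       (cong (_+ sum1 cTerm L) (sum1-+ minGenTerm bTerm L)))))) ⟩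
    suc (sum1 (λ r → minGenTerm r + bTerm r + cTerm r + dTerm r) L)
      ≡⟨ cong suc (trans (sum1-cong _ _ L counted-once) (trans (sum1-const 1 L) (*-identityʳ L))) ⟩
    m
      ∎
    where open ≡-Reasoning

-- From the integer parameters k₁, k₂ to K = k₁ + 1 and D = k₂ − k₁

ℤ-cancelʳ-≤ : ∀ {i j} c → i ℤ.+ c ℤ.≤ j ℤ.+ c → i ℤ.≤ j
ℤ-cancelʳ-≤ {i} {j} c le = subst₂ ℤ._≤_ (cancel i c) (cancel j c) (ℤP.+-monoˡ-≤ (ℤ.- c) le)
  where
  cancel : ∀ i c → i ℤ.+ c ℤ.- c ≡ i
  cancel = ℤR.solve-∀

ℤ-sub-transpose : ∀ a b c → (a ≡ b ℤ.- c) ⇔ (a ℤ.+ c ≡ b)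
ℤ-sub-transpose a b c = mk⇔
  (λ a≡ → trans (cong (ℤ._+ c) a≡) (cancelˡ b c))
  (λ a+c≡ → trans (sym (cancelʳ a c)) (cong (ℤ._- c) a+c≡))
  where
  cancelˡ : ∀ b c → b ℤ.- c ℤ.+ c ≡ b
  cancelˡ = ℤR.solve-∀
  cancelʳ : ∀ a c → a ℤ.+ c ℤ.- c ≡ a
  cancelʳ = ℤR.solve-∀

-- Conditions (1)–(5) with K = k₁ + 1 and D = k₂ − k₁ in place of k₁ and k₂.
record ValidSeqℕ (L K D : ℕ) (x : ℕ → ℕ) : Set where
  field
    condition1 : ∀ i → 1 ≤ i → i ≤ L → x i ≡ 1 ⊎ x i ≡ 2 ⊎ x i ≡ 3
    condition2 : ∀ i → 1 ≤ i → i ≤ L → 2 * K ≤ i + 2 → x i ≡ 1 ⊎ x i ≡ 2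
    condition3 : ∀ i₁ i₂ i₃ → 1 ≤ i₁ → suc i₁ ≤ 2 * K → 1 ≤ i₂ → suc i₂ ≤ 2 * K → 1 ≤ i₃ → suc i₃ ≤ 2 * K →
                 i₁ + i₂ ≡ i₃ → ¬ (x i₁ ≡ 1 × x i₂ ≡ 1 × x i₃ ≡ 3)
    condition4 : Statistics.d L K x + aOf (Statistics.t L K x) x + 2 * bOf (Statistics.t L K x) x ≡ K
    condition5 : aOf (Statistics.t L K x) x + bOf (Statistics.t L K x) x + D ≡ K + cOf (Statistics.t L K x) x

module Parameters (k₁ k₂ : ℤ) (K D : ℕ) (K≡ : k₁ ℤ.+ + 1 ≡ + K) (k₂≡ : k₂ ≡ k₁ ℤ.+ + D) where

  2k₁+2≡ : + 2 ℤ.* k₁ ℤ.+ + 2 ≡ + (2 * K)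
  2k₁+2≡ = trans (distrib k₁) (trans (cong (λ z → + 2 ℤ.* z) K≡) (sym (ℤP.pos-* 2 K)))
    where
    distrib : ∀ k → + 2 ℤ.* k ℤ.+ + 2 ≡ + 2 ℤ.* (k ℤ.+ + 1)
    distrib = ℤR.solve-∀

  2k₁+1≡ : + 2 ℤ.* k₁ ℤ.+ + 1 ≡ + (2 * K) ℤ.+ -[1+ 0 ]
  2k₁+1≡ = trans (shift k₁) (cong (ℤ._+ -[1+ 0 ]) 2k₁+2≡)
    where
    shift : ∀ k → + 2 ℤ.* k ℤ.+ + 1 ≡ (+ 2 ℤ.* k ℤ.+ + 2) ℤ.+ -[1+ 0 ]
    shift = ℤR.solve-∀

  t≡ : clamp (+ 2 ℤ.* k₁ ℤ.+ + 1) ≡ 2 * K ∸ 1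
  t≡ = trans (cong clamp 2k₁+1≡) (clamp-pred (2 * K))
    where
    clamp-pred : ∀ n → clamp (+ n ℤ.+ -[1+ 0 ]) ≡ n ∸ 1
    clamp-pred zero    = refl
    clamp-pred (suc n) = refl

  condition2⇔ : ∀ i → (+ 2 ℤ.* k₁ ℤ.≤ + i) ⇔ (2 * K ≤ i + 2)
  condition2⇔ i = mk⇔
    (λ le → ℤP.drop‿+≤+ (subst₂ ℤ._≤_ 2k₁+2≡ (sym (ℤP.pos-+ i 2)) (ℤP.+-monoˡ-≤ (+ 2) le)))
    (λ le → ℤ-cancelʳ-≤ (+ 2) (subst₂ ℤ._≤_ (sym 2k₁+2≡) (ℤP.pos-+ i 2) (ℤ.+≤+ le)))

  condition3⇔ : ∀ i → (+ i ℤ.≤ + 2 ℤ.* k₁ ℤ.+ + 1) ⇔ (suc i ≤ 2 * K)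
  condition3⇔ i = mk⇔
    (λ le → ℤP.drop‿+≤+ (subst₂ ℤ._≤_ (sym (suc≡ i)) (trans (+1 k₁) 2k₁+2≡) (ℤP.+-monoˡ-≤ (+ 1) le)))
    (λ le → ℤ-cancelʳ-≤ (+ 1) (subst₂ ℤ._≤_ (suc≡ i) (sym (trans (+1 k₁) 2k₁+2≡)) (ℤ.+≤+ le)))
    where
    suc≡ : ∀ i → + suc i ≡ + i ℤ.+ + 1
    suc≡ i = trans (cong +_ (+-comm 1 i)) (ℤP.pos-+ i 1)
    +1 : ∀ k → + 2 ℤ.* k ℤ.+ + 1 ℤ.+ + 1 ≡ + 2 ℤ.* k ℤ.+ + 2
    +1 = ℤR.solve-∀

  condition4⇔ : ∀ d a b → (+ d ≡ k₁ ℤ.+ + 1 ℤ.- + a ℤ.- + 2 ℤ.* + b) ⇔ (d + a + 2 * b ≡ K)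
  condition4⇔ d a b = mk⇔
    (λ eq → ℤP.+-injective (trans cast (trans (cong (λ z → z ℤ.+ + a ℤ.+ + 2 ℤ.* + b) eq) (trans (cancel (k₁ ℤ.+ + 1) (+ a) (+ b)) K≡))))
    (λ eq → trans (sym (cancel' (+ d) (+ a) (+ b))) (cong (λ z → z ℤ.- + a ℤ.- + 2 ℤ.* + b) (trans (sym cast) (trans (cong +_ eq) (sym K≡)))))
    where
    cast : + (d + a + 2 * b) ≡ + d ℤ.+ + a ℤ.+ + 2 ℤ.* + b
    cast = trans (ℤP.pos-+ (d + a) (2 * b)) (cong₂ ℤ._+_ (ℤP.pos-+ d a) (ℤP.pos-* 2 b))
    cancel : ∀ k a b → k ℤ.- a ℤ.- + 2 ℤ.* b ℤ.+ a ℤ.+ + 2 ℤ.* b ≡ k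
    cancel = ℤR.solve-∀
    cancel' : ∀ d a b → d ℤ.+ a ℤ.+ + 2 ℤ.* b ℤ.- a ℤ.- + 2 ℤ.* b ≡ d
    cancel' = ℤR.solve-∀

  2k₁+1-k₂≡ : + 2 ℤ.* k₁ ℤ.+ + 1 ℤ.- k₂ ≡ + K ℤ.- + D
  2k₁+1-k₂≡ = trans (cong (λ z → + 2 ℤ.* k₁ ℤ.+ + 1 ℤ.- z) k₂≡) (trans (simplify k₁ (+ D)) (cong (ℤ._- + D) K≡))
    where
    simplify : ∀ k d → + 2 ℤ.* k ℤ.+ + 1 ℤ.- (k ℤ.+ d) ≡ k ℤ.+ + 1 ℤ.- d
    simplify = ℤR.solve-∀

  condition5⇔ : ∀ a b c → (+ a ℤ.+ + b ℤ.- + c ≡ + 2 ℤ.* k₁ ℤ.+ + 1 ℤ.- k₂) ⇔ (a + b + D ≡ K + c)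
  condition5⇔ a b c = mk⇔
    (λ eq → ℤP.+-injective (begin
      + (a + b + D)                         ≡⟨ cast ⟩
      + a ℤ.+ + b ℤ.+ + D                   ≡⟨ sym (move (+ a) (+ b) (+ c) (+ D)) ⟩
      (+ a ℤ.+ + b ℤ.- + c) ℤ.+ + c ℤ.+ + D ≡⟨ cong (λ z → z ℤ.+ + c ℤ.+ + D) (trans eq 2k₁+1-k₂≡) ⟩
      + K ℤ.- + D ℤ.+ + c ℤ.+ + D           ≡⟨ move' (+ K) (+ c) (+ D) ⟩
      + K ℤ.+ + c                           ≡⟨ sym (ℤP.pos-+ K c) ⟩
      + (K + c)                             ∎))
    (λ eq → begin
      + a ℤ.+ + b ℤ.- + c                   ≡⟨ sym (move'' (+ a) (+ b) (+ c) (+ D)) ⟩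
      + a ℤ.+ + b ℤ.+ + D ℤ.- + c ℤ.- + D   ≡⟨ cong (λ z → z ℤ.- + c ℤ.- + D) (trans (sym cast) (trans (cong +_ eq) (ℤP.pos-+ K c))) ⟩
      + K ℤ.+ + c ℤ.- + c ℤ.- + D           ≡⟨ move''' (+ K) (+ c) (+ D) ⟩
      + K ℤ.- + D                           ≡⟨ sym 2k₁+1-k₂≡ ⟩
      + 2 ℤ.* k₁ ℤ.+ + 1 ℤ.- k₂             ∎)
    where
    open ≡-Reasoning
    cast : + (a + b + D) ≡ + a ℤ.+ + b ℤ.+ + D
    cast = trans (ℤP.pos-+ (a + b) D) (cong (ℤ._+ + D) (ℤP.pos-+ a b))
    move : ∀ a b c d → a ℤ.+ b ℤ.- c ℤ.+ c ℤ.+ d ≡ a ℤ.+ b ℤ.+ d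
    move = ℤR.solve-∀
    move' : ∀ k c d → k ℤ.- d ℤ.+ c ℤ.+ d ≡ k ℤ.+ c
    move' = ℤR.solve-∀
    move'' : ∀ a b c d → a ℤ.+ b ℤ.+ d ℤ.- c ℤ.- d ≡ a ℤ.+ b ℤ.- c
    move'' = ℤR.solve-∀
    move''' : ∀ k c d → k ℤ.+ c ℤ.- c ℤ.- d ≡ k ℤ.- d
    move''' = ℤR.solve-∀

  genus⇔ : ∀ L g → (+ g ≡ + suc L ℤ.+ k₁) ⇔ (g ≡ L + K)
  genus⇔ L g = mk⇔ (λ eq → ℤP.+-injective (trans eq m+k₁≡)) (λ eq → trans (cong +_ eq) (sym m+k₁≡))
    where
    m+k₁≡ : + suc L ℤ.+ k₁ ≡ + (L + K)
    m+k₁≡ = trans (cong (ℤ._+ k₁) (ℤP.pos-+ 1 L)) (trans (regroup (+ L) k₁) (trans (cong (λ z → + L ℤ.+ z) K≡) (sym (ℤP.pos-+ L K))))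
      where
      regroup : ∀ l k → + 1 ℤ.+ l ℤ.+ k ≡ l ℤ.+ (k ℤ.+ + 1)
      regroup = ℤR.solve-∀

  embDim⇔ : ∀ L e → (+ e ≡ + (L + K) ℤ.- k₂) ⇔ (e + D ≡ suc L)
  embDim⇔ L e = mk⇔
    (λ eq → ℤP.+-injective (trans (ℤP.pos-+ e D) (Equivalence.to (ℤ-sub-transpose (+ e) (+ suc L) (+ D)) (trans eq g-k₂≡))))
    (λ eq → trans (Equivalence.from (ℤ-sub-transpose (+ e) (+ suc L) (+ D)) (trans (sym (ℤP.pos-+ e D)) (cong +_ eq))) (sym g-k₂≡))
    where
    g-k₂≡ : + (L + K) ℤ.- k₂ ≡ + suc L ℤ.- + D
    g-k₂≡ = trans (cong₂ ℤ._-_ (trans (ℤP.pos-+ L K) (cong (λ z → + L ℤ.+ z) (sym K≡))) k₂≡)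
                  (trans (simplify (+ L) k₁ (+ D)) (cong (ℤ._- + D) (sym (ℤP.pos-+ 1 L))))
      where
      simplify : ∀ l k d → l ℤ.+ (k ℤ.+ + 1) ℤ.- (k ℤ.+ d) ≡ + 1 ℤ.+ l ℤ.- d
      simplify = ℤR.solve-∀

  module _ {L : ℕ} (xs : Vec ℕ L) where
    open Statistics L K (at xs)

    validSeq⇔ : ValidSeq (suc L) k₁ k₂ xs ⇔ ValidSeqℕ L K D (at xs)
    validSeq⇔ = mk⇔
      (λ (v₁ , v₂ , v₃ , v₄ , v₅) → record
        { condition1 = v₁
        ; condition2 = λ i 1≤i i≤L le → v₂ i 1≤i i≤L (Equivalence.from (condition2⇔ i) le)
        ; condition3 = λ i₁ i₂ i₃ p₁ q₁ p₂ q₂ p₃ q₃ → v₃ i₁ i₂ i₃ p₁ (ℕ⇒ℤ i₁ q₁) p₂ (ℕ⇒ℤ i₂ q₂) p₃ (ℕ⇒ℤ i₃ q₃)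
        ; condition4 = Equivalence.to (condition4⇔ d (aOf t x) (bOf t x)) (cast4 v₄)
        ; condition5 = Equivalence.to (condition5⇔ (aOf t x) (bOf t x) (cOf t x)) (cast5 v₅)
        })
      (λ v → let open ValidSeqℕ v in
          condition1
        , (λ i 1≤i i≤L le → condition2 i 1≤i i≤L (Equivalence.to (condition2⇔ i) le))
        , (λ i₁ i₂ i₃ p₁ q₁ p₂ q₂ p₃ q₃ → condition3 i₁ i₂ i₃ p₁ (ℤ⇒ℕ i₁ q₁) p₂ (ℤ⇒ℕ i₂ q₂) p₃ (ℤ⇒ℕ i₃ q₃))
        , cast4⁻¹ (Equivalence.from (condition4⇔ d (aOf t x) (bOf t x)) condition4)
        , cast5⁻¹ (Equivalence.from (condition5⇔ (aOf t x) (bOf t x) (cOf t x)) condition5))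
      where
      x : ℕ → ℕ
      x = at xs
      -- the length of x̄ as ValidSeq computes it; t≡ identifies it with t = 2K − 1
      t' : ℕ
      t' = clamp (+ 2 ℤ.* k₁ ℤ.+ + 1)
      ℤ⇒ℕ : ∀ i → + i ℤ.≤ + 2 ℤ.* k₁ ℤ.+ + 1 → suc i ≤ 2 * K
      ℤ⇒ℕ i = Equivalence.to (condition3⇔ i)
      ℕ⇒ℤ : ∀ i → suc i ≤ 2 * K → + i ℤ.≤ + 2 ℤ.* k₁ ℤ.+ + 1
      ℕ⇒ℤ i = Equivalence.from (condition3⇔ i)
      cast4 : + count1 (λ i → (+ 2 ℤ.* k₁ ℤ.+ + 2 ℤ.≤ᵇ + i) ∧ (x i == 2)) L ≡ k₁ ℤ.+ + 1 ℤ.- + aOf t' x ℤ.- + 2 ℤ.* + bOf t' x →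
              + d ≡ k₁ ℤ.+ + 1 ℤ.- + aOf t x ℤ.- + 2 ℤ.* + bOf t x
      cast4 eq rewrite t≡ | 2k₁+2≡ = eq
      cast4⁻¹ : + d ≡ k₁ ℤ.+ + 1 ℤ.- + aOf t x ℤ.- + 2 ℤ.* + bOf t x →
                + count1 (λ i → (+ 2 ℤ.* k₁ ℤ.+ + 2 ℤ.≤ᵇ + i) ∧ (x i == 2)) L ≡ k₁ ℤ.+ + 1 ℤ.- + aOf t' x ℤ.- + 2 ℤ.* + bOf t' x
      cast4⁻¹ eq rewrite t≡ | 2k₁+2≡ = eq
      cast5 : + aOf t' x ℤ.+ + bOf t' x ℤ.- + cOf t' x ≡ + 2 ℤ.* k₁ ℤ.+ + 1 ℤ.- k₂ →
              + aOf t x ℤ.+ + bOf t x ℤ.- + cOf t x ≡ + 2 ℤ.* k₁ ℤ.+ + 1 ℤ.- k₂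
      cast5 eq rewrite t≡ = eq
      cast5⁻¹ : + aOf t x ℤ.+ + bOf t x ℤ.- + cOf t x ≡ + 2 ℤ.* k₁ ℤ.+ + 1 ℤ.- k₂ →
                + aOf t' x ℤ.+ + bOf t' x ℤ.- + cOf t' x ≡ + 2 ℤ.* k₁ ℤ.+ + 1 ℤ.- k₂
      cast5⁻¹ eq rewrite t≡ = eq

module Correspondence (k₁ k₂ : ℤ) (K D L : ℕ)
  (K≡ : k₁ ℤ.+ + 1 ≡ + K) (k₂≡ : k₂ ≡ k₁ ℤ.+ + D) (2K≤m : 2 * K ≤ suc L)
  where
  open Parameters k₁ k₂ K D K≡ k₂≡
  open Kunz L using (m; m≡0+1*m; module KunzCoordinates; KunzInequalities; kunzMem; kunzMem-decomp;
                     kunzMem-closed; kunzMem-above; kunz-genus; wrapped-residue)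

  condition4⇔sum : ∀ s a b d → s ≡ L + (a + d) + 2 * b → (s ≡ L + K) ⇔ (d + a + 2 * b ≡ K)
  condition4⇔sum s a b d s≡ = mk⇔
    (λ eq → +-cancelˡ-≡ L _ _ (trans (sym (regroup L a b d)) (trans (sym s≡) eq)))
    (λ eq → trans s≡ (trans (regroup L a b d) (cong (λ z → L + z) eq)))
    where
    regroup : ∀ L a b d → L + (a + d) + 2 * b ≡ L + (d + a + 2 * b)
    regroup = solve-∀

  condition5⇔D : ∀ a b c d → d + a + 2 * b ≡ K → (a + b + D ≡ K + c) ⇔ (D ≡ b + c + d)
  condition5⇔D a b c d K≡' = mk⇔
    (λ eq → +-cancelˡ-≡ (a + b) _ _ (trans eq (trans (cong (_+ c) (sym K≡')) (sym (regroup a b c d)))))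
    (λ eq → trans (cong (λ z → a + b + z) eq) (trans (regroup a b c d) (cong (_+ c) K≡')))
    where
    regroup : ∀ a b c d → a + b + (b + c + d) ≡ d + a + 2 * b + c
    regroup = solve-∀

  3≰2 : ¬ 3 ≤ 2
  3≰2 (s≤s (s≤s ()))

  coordinates : SemigroupsWith m k₁ k₂ → Vec ℕ L
  coordinates (S , mult , _) = KunzCoordinates.vec S mult

  coordinates-valid : (s : SemigroupsWith m k₁ k₂) → ValidSeqℕ L K D (at (coordinates s))
  coordinates-valid (S , mult , g , e , hg , he , g≡ , e≡) = record
    { condition1 = x∈123 ; condition2 = v₂ ; condition3 = v₃ ; condition4 = v₄ ; condition5 = v₅ }
    where
    open KunzCoordinates S mult
    g≡L+K : g ≡ L + K
    g≡L+K = Equivalence.to (genus⇔ L g) g≡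
    sum≡ : sum1 x L ≡ L + K
    sum≡ = trans (genus≡sum g hg) g≡L+K
    open EmbeddingDimension L K S x mem-decomp x0≡0 x-positive kunzInequalities sum≡ 2K≤m
    v₂ : ∀ i → 1 ≤ i → i ≤ L → 2 * K ≤ i + 2 → x i ≡ 1 ⊎ x i ≡ 2
    v₂ i 1≤i i≤L 2K≤i+2 with x∈123 i 1≤i i≤L
    ... | inj₁ xi≡1        = inj₁ xi≡1
    ... | inj₂ (inj₁ xi≡2) = inj₂ xi≡2
    ... | inj₂ (inj₂ xi≡3) = ⊥-elim (3≰2 (+-cancelˡ-≤ i 3 2 (≤-trans (x≡3⇒i+3≤2K i 1≤i i≤L xi≡3) 2K≤i+2)))
    v₃ : ∀ i₁ i₂ i₃ → 1 ≤ i₁ → suc i₁ ≤ 2 * K → 1 ≤ i₂ → suc i₂ ≤ 2 * K → 1 ≤ i₃ → suc i₃ ≤ 2 * K →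
      i₁ + i₂ ≡ i₃ → ¬ (x i₁ ≡ 1 × x i₂ ≡ 1 × x i₃ ≡ 3)
    v₃ i₁ i₂ i₃ _ i₁<2K _ i₂<2K _ i₃<2K refl (xi₁≡1 , xi₂≡1 , xi₃≡3) =
      3≰2 (subst₂ _≤_ xi₃≡3 (cong₂ _+_ xi₁≡1 xi₂≡1)
        (proj₁ (kunzInequalities i₁ i₂ (≤-trans i₁<2K 2K≤m) (≤-trans i₂<2K 2K≤m)) (≤-trans i₃<2K 2K≤m)))
    v₄ : d + aOf t x + 2 * bOf t x ≡ K
    v₄ = Equivalence.to (condition4⇔sum (sum1 x L) (aOf t x) (bOf t x) d (sum-x≡ x∈123 x≡3⇒r<2K t≤L)) sum≡
    e≡count : e ≡ countBelow (isMinGen S) (4 * m)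
    e≡count = hasCard-unique (isMinGen S) e (4 * m) he (notMinGen-beyond x<m⇒x≤3)
    e+D≡m : e + D ≡ m
    e+D≡m = Equivalence.to (embDim⇔ L e) (subst (λ g → + e ≡ + g ℤ.- k₂) g≡L+K e≡)
    v₅ : aOf t x + bOf t x + D ≡ K + cOf t x
    v₅ = Equivalence.from (condition5⇔D (aOf t x) (bOf t x) (cOf t x) d v₄) (+-cancelˡ-≡ e _ _ (begin
      e + D                                  ≡⟨ e+D≡m ⟩
      m                                      ≡⟨ sym minGen-identity ⟩
      countBelow (isMinGen S) (4 * m) + bOf t x + cOf t x + d ≡⟨ cong (λ z → z + bOf t x + cOf t x + d) (sym e≡count) ⟩
      e + bOf t x + cOf t x + d              ≡⟨ assoc e (bOf t x) (cOf t x) d ⟩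
      e + (bOf t x + cOf t x + d)            ∎))
      where
      open ≡-Reasoning
      assoc : ∀ e b c d → e + b + c + d ≡ e + (b + c + d)
      assoc = solve-∀

  module FromSequence (xs : Vec ℕ L) (valid : ValidSeqℕ L K D (at xs)) where
    open Statistics L K (at xs)
    open ValidSeqℕ valid

    x : ℕ → ℕ
    x = at xs

    x0≡0 : x 0 ≡ 0
    x0≡0 = at-0 xs

    x∈123 : ∀ r → 1 ≤ r → r ≤ L → x r ≡ 1 ⊎ x r ≡ 2 ⊎ x r ≡ 3
    x∈123 = condition1

    x-positive : ∀ r → 1 ≤ r → r < m → 1 ≤ x r
    x-positive r 1≤r (s≤s r≤L) with x∈123 r 1≤r r≤L
    ... | inj₁ xr≡1        = ≤-reflexive (sym xr≡1)
    ... | inj₂ (inj₁ xr≡2) = subst (1 ≤_) (sym xr≡2) (s≤s z≤n)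
    ... | inj₂ (inj₂ xr≡3) = subst (1 ≤_) (sym xr≡3) (s≤s z≤n)

    x≤3 : ∀ r → r < m → x r ≤ 3
    x≤3 zero    _         = subst (_≤ 3) (sym x0≡0) z≤n
    x≤3 (suc r) (s≤s r<L) with x∈123 (suc r) (s≤s z≤n) r<L
    ... | inj₁ xr≡1        = subst (_≤ 3) (sym xr≡1) (s≤s z≤n)
    ... | inj₂ (inj₁ xr≡2) = subst (_≤ 3) (sym xr≡2) (s≤s (s≤s z≤n))
    ... | inj₂ (inj₂ xr≡3) = subst (_≤ 3) (sym xr≡3) ≤-refl

    x≡3⇒r<2K : ∀ r → 1 ≤ r → r ≤ L → x r ≡ 3 → suc r ≤ 2 * K
    x≡3⇒r<2K r 1≤r r≤L xr≡3 with 2 * K ℕ.≤? r + 2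
    ... | no 2K≰r+2 = ≤-trans (s≤s (m≤m+n r 2)) (≰⇒> 2K≰r+2)
    ... | yes 2K≤r+2 with condition2 r 1≤r r≤L 2K≤r+2
    ...   | inj₁ xr≡1 with trans (sym xr≡3) xr≡1
    ...     | ()
    x≡3⇒r<2K r 1≤r r≤L xr≡3 | yes _ | inj₂ xr≡2 with trans (sym xr≡3) xr≡2
    ...     | ()

    t≤L : t ≤ L
    t≤L = ∸-monoˡ-≤ 1 2K≤m

    sum≡ : sum1 x L ≡ L + K
    sum≡ = Equivalence.from (condition4⇔sum (sum1 x L) (aOf t x) (bOf t x) d (sum-x≡ x∈123 x≡3⇒r<2K t≤L))
                            condition4

    direct-inequality : ∀ j k → j + k < m → x (j + k) ≤ x j + x k
    direct-inequality zero    k       _   = m≤n+m (x k) (x 0)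
    direct-inequality (suc j) zero    _   = subst (λ i → x i ≤ x (suc j) + x 0) (sym (+-identityʳ (suc j))) (m≤m+n _ _)
    direct-inequality (suc j) (suc k) i<m = bound (x∈123 i (s≤s z≤n) (≤-pred i<m))
      where
      i : ℕ
      i = suc j + suc k
      j<m : suc j < m
      j<m = ≤-<-trans (m≤m+n (suc j) (suc k)) i<m
      k<m : suc k < m
      k<m = ≤-<-trans (m≤n+m (suc k) (suc j)) i<m
      two≤ : 2 ≤ x (suc j) + x (suc k)
      two≤ = +-mono-≤ (x-positive (suc j) (s≤s z≤n) j<m) (x-positive (suc k) (s≤s z≤n) k<m)
      -- x i = 3 forces i < 2K, and then condition (3) excludes x j = x k = 1.
      bound : x i ≡ 1 ⊎ x i ≡ 2 ⊎ x i ≡ 3 → x i ≤ x (suc j) + x (suc k)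
      bound (inj₁ xi≡1)        = subst (_≤ x (suc j) + x (suc k)) (sym xi≡1) (≤-trans (s≤s z≤n) two≤)
      bound (inj₂ (inj₁ xi≡2)) = subst (_≤ x (suc j) + x (suc k)) (sym xi≡2) two≤
      bound (inj₂ (inj₂ xi≡3)) = subst (_≤ x (suc j) + x (suc k)) (sym xi≡3)
        (≥3-unless-both-one _ _ (x-positive (suc j) (s≤s z≤n) j<m) (x-positive (suc k) (s≤s z≤n) k<m)
          (∧-false _ _ (λ xj xk → condition3 (suc j) (suc k) i
            (s≤s z≤n) j<2K (s≤s z≤n) k<2K (s≤s z≤n) i<2K refl (==-true⇒≡ _ _ xj , ==-true⇒≡ _ _ xk , xi≡3))))
        where
        i<2K : suc i ≤ 2 * K
        i<2K = x≡3⇒r<2K i (s≤s z≤n) (≤-pred i<m) xi≡3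
        j<2K : suc (suc j) ≤ 2 * K
        j<2K = ≤-trans (s≤s (m≤m+n (suc j) (suc k))) i<2K
        k<2K : suc (suc k) ≤ 2 * K
        k<2K = ≤-trans (s≤s (m≤n+m (suc k) (suc j))) i<2K

    wrapped-inequality : ∀ j k → j < m → k < m → m ≤ j + k → x (j + k ∸ m) ≤ suc (x j + x k)
    wrapped-inequality zero    k       _   k<m m≤k   = ⊥-elim (<⇒≱ k<m m≤k)
    wrapped-inequality (suc j) zero    j<m _   m≤j+0 = ⊥-elim (<⇒≱ j<m (subst (m ≤_) (+-identityʳ (suc j)) m≤j+0))
    wrapped-inequality (suc j) (suc k) j<m k<m m≤j+k =
      ≤-trans (x≤3 _ (proj₁ (wrapped-residue j<m k<m m≤j+k)))
              (s≤s (+-mono-≤ (x-positive (suc j) (s≤s z≤n) j<m) (x-positive (suc k) (s≤s z≤n) k<m)))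

    kunzInequalities : KunzInequalities x
    kunzInequalities j k j<m k<m = direct-inequality j k , wrapped-inequality j k j<m k<m

    semigroup : NumericalSemigroup
    semigroup = record
      { mem      = kunzMem x
      ; zero-mem = trans (kunzMem-decomp x 0 0 (s≤s z≤n)) (cong (_≤ᵇ 0) x0≡0)
      ; closed   = kunzMem-closed x kunzInequalities
      ; cofinite = 3 * m , λ n 3m≤n → kunzMem-above x 3 n x≤3 3m≤n
      }

    multiplicity : IsMultiplicity semigroup m
    multiplicity =
        s≤s z≤n
      , trans (cong (kunzMem x) m≡0+1*m) (trans (kunzMem-decomp x 0 1 (s≤s z≤n)) (cong (_≤ᵇ 1) x0≡0))
      , λ n 1≤n n<m → trans (cong (kunzMem x) (sym (+-identityʳ n)))
                            (trans (kunzMem-decomp x n 0 n<m) (≤ᵇ-false (x n) 0 (x-positive n 1≤n n<m)))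

    open EmbeddingDimension L K semigroup x (kunzMem-decomp x) x0≡0 x-positive kunzInequalities sum≡ 2K≤m
      using (minGen-identity; notMinGen-beyond; x<m⇒x≤3)

    embDim : ℕ
    embDim = countBelow (isMinGen semigroup) (4 * m)

    embDim+D≡m : embDim + D ≡ m
    embDim+D≡m = begin
      embDim + D                          ≡⟨ cong (λ z → embDim + z) D≡ ⟩
      embDim + (bOf t x + cOf t x + d)    ≡⟨ assoc embDim (bOf t x) (cOf t x) d ⟩
      embDim + bOf t x + cOf t x + d      ≡⟨ minGen-identity ⟩
      m                                   ∎
      where
      open ≡-Reasoning
      D≡ : D ≡ bOf t x + cOf t x + d
      D≡ = Equivalence.to (condition5⇔D (aOf t x) (bOf t x) (cOf t x) d condition4) condition5
      assoc : ∀ e b c d → e + (b + c + d) ≡ e + b + c + d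
      assoc = solve-∀

    element : SemigroupsWith m k₁ k₂
    element = semigroup , multiplicity , L + K , embDim
      , (3 * m , (λ n 3m≤n → cong not (kunzMem-above x 3 n x≤3 3m≤n)) , trans (kunz-genus x 3 x0≡0 x≤3) sum≡)
      , (4 * m , notMinGen-beyond x<m⇒x≤3 , refl)
      , Equivalence.from (genus⇔ L (L + K)) refl
      , Equivalence.from (embDim⇔ L embDim) embDim+D≡m

  coordinates-cong : ∀ {A B : SemigroupsWith m k₁ k₂} →
    (∀ n → mem (proj₁ A) n ≡ mem (proj₁ B) n) → coordinates A ≡ coordinates B
  coordinates-cong {S , mS , _} {S' , mS' , _} same = tabulate1-cong _ _ L (λ r _ _ →
    sym (B.coord-unique r (A.coord r) (trans (sym (same _)) (proj₁ (A.coord-spec r)))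
                                      (λ q q<c → trans (sym (same _)) (proj₂ (A.coord-spec r) q q<c))))
    where
    module A = KunzCoordinates S mS
    module B = KunzCoordinates S' mS'

  coordinates-injective : ∀ {A B : SemigroupsWith m k₁ k₂} →
    coordinates A ≡ coordinates B → ∀ n → mem (proj₁ A) n ≡ mem (proj₁ B) n
  coordinates-injective {S , mS , _} {S' , mS' , _} eq n =
    trans (KunzCoordinates.mem≡kunzMem S mS n) (trans (cong (λ v → kunzMem (at v) n) eq) (sym (KunzCoordinates.mem≡kunzMem S' mS' n)))

  coordinates-of-element : ∀ (xs : Vec ℕ L) (z : SemigroupsWith m k₁ k₂) →
    (∀ n → mem (proj₁ z) n ≡ kunzMem (at xs) n) → coordinates z ≡ xs
  coordinates-of-element xs (S , mS , _) same = trans (tabulate1-cong _ (at xs) L coord≡x) (tabulate1-at xs)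
    where
    open KunzCoordinates S mS using (coord-unique)
    coord≡x : ∀ r → 1 ≤ r → r ≤ L → KunzCoordinates.coord S mS r ≡ at xs r
    coord≡x r _ r≤L = coord-unique r (at xs r)
      (trans (same _) (trans (kunzMem-decomp (at xs) r (at xs r) (s≤s r≤L)) (≤ᵇ-true (at xs r) (at xs r) ≤-refl)))
      (λ q q<xr → trans (same _) (trans (kunzMem-decomp (at xs) r q (s≤s r≤L)) (≤ᵇ-false (at xs r) q q<xr)))

  bijection : Bijection (SemigroupSetoid m k₁ k₂) (SequenceSetoid m k₁ k₂)
  bijection = record
    { to        = λ s → coordinates s , Equivalence.from (validSeq⇔ (coordinates s)) (coordinates-valid s)
    ; cong      = λ {A} {B} → coordinates-cong {A} {B}
    ; bijective = (λ {A} {B} → coordinates-injective {A} {B})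
                , λ (xs , valid) → let validℕ = Equivalence.to (validSeq⇔ xs) valid in
                    FromSequence.element xs validℕ , λ {z} → coordinates-of-element xs z
    }

-1≤k⇒k+1≡+ : ∀ k → -[1+ 0 ] ℤ.≤ k → Σ ℕ λ K → k ℤ.+ + 1 ≡ + K
-1≤k⇒k+1≡+ (+ n)        _          = suc n , trans (sym (ℤP.pos-+ n 1)) (cong +_ (+-comm n 1))
-1≤k⇒k+1≡+ -[1+ zero ]  _          = 0 , refl
-1≤k⇒k+1≡+ -[1+ suc n ] (ℤ.-≤- ())

≤⇒≡+∣-∣ : ∀ {i j} → i ℤ.≤ j → j ≡ i ℤ.+ + ℤ.∣ j ℤ.- i ∣
≤⇒≡+∣-∣ {i} {j} i≤j = trans (split i j) (cong (λ z → i ℤ.+ z) (sym (ℤP.0≤i⇒+∣i∣≡i (ℤP.i≤j⇒0≤j-i i≤j))))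
  where
  split : ∀ a b → b ≡ a ℤ.+ (b ℤ.- a)
  split = ℤR.solve-∀

theorem8p5 : (k₁ k₂ : ℤ) (m : ℕ) →
    -[1+ 0 ] ℤ.≤ k₁ → k₁ ℤ.≤ k₂ → + 2 ℤ.* k₁ ℤ.+ + 2 ℤ.≤ + m → 1 ≤ m →
    Bijection (SemigroupSetoid m k₁ k₂) (SequenceSetoid m k₁ k₂)
theorem8p5 k₁ k₂ (suc L) -1≤k₁ k₁≤k₂ 2k₁+2≤m _ with -1≤k⇒k+1≡+ k₁ -1≤k₁
... | K , K≡ = Correspondence.bijection k₁ k₂ K D L K≡ k₂≡ 2K≤m
  where
  D : ℕ
  D = ℤ.∣ k₂ ℤ.- k₁ ∣
  k₂≡ : k₂ ≡ k₁ ℤ.+ + D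
  k₂≡ = ≤⇒≡+∣-∣ k₁≤k₂
  2K≤m : 2 * K ≤ suc L
  2K≤m = ℤP.drop‿+≤+ (subst (ℤ._≤ + suc L) (Parameters.2k₁+2≡ k₁ k₂ K D K≡ k₂≡) 2k₁+2≤m)
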